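{- Let $\sigma$ be a partition of a positive integer $r$ with largest part $\Delta$ and smallest part $\delta$, let $n,q$ be positive integers, let $H=H(n,r,q\mid\sigma)$, and write $s=s(\sigma)$. Let $\alpha,\beta$ be integers with $2\le\alpha$, $\Delta \geq \alpha$, $\delta \leq r-\beta$ and $\alpha \leq s \leq \beta$. Suppose \[ q=(\beta-\alpha+1) \left\lfloor \frac{\Delta-1}{\alpha-1} \right\rfloor + \Delta -1 \quad\text{and}\quad n \geq \binom{\beta +1}{\alpha -1}(s-1) + s. \] Then: (1) $H$ has no $k$-$(\alpha,\beta)$-colouring for any $k \leq \beta- 1$; (2) $H$ has a $\beta$-$(\alpha,\beta)$-colouring; (3) $H$ has no $(\beta+1)$-$(\alpha,\beta)$-colouring; (4) $H$ has a $k$-$(\alpha,\beta)$-colouring for every integer $k$ with \[ \left\lceil \frac{ n-\left(s-1- (\alpha -1) \left\lfloor \frac{s-1}{\alpha -1} \right\rfloor\right) }{\left\lfloor \frac{s - 1}{\alpha - 1} \right\rfloor} \right\rceil \le k \le n. \] Consequently the $(\alpha,\beta)$-spectrum of $H$ has a gap.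
   Context: For a partition $\sigma$ of $r$ and positive integers $n,q$, the $\sigma$-hypergraph $H(n,r,q\mid\sigma)$ is the $r$-uniform hypergraph whose vertex set has $nq$ vertices partitioned into $n$ classes $V_1,\dots,V_n$ of $q$ vertices each, and in which an $r$-subset $K$ of the vertex set is an edge if and only if the multiset of non-zero cardinalities $|K\cap V_i|$, $1\le i\le n$, is exactly the partition $\sigma$. $s(\sigma)$ denotes the number of parts of $\sigma$, $\Delta$ its largest part and $\delta$ its smallest part. For integers $\alpha\le\beta$, an $(\alpha,\beta)$-colouring is an assignment of colours to the vertices such that every edge contains at least $\alpha$ and at most $\beta$ distinct colours; a $k$-$(\alpha,\beta)$-colouring is one using exactly $k$ colours. The $(\alpha,\beta)$-spectrum is the set of $k$ for which a $k$-$(\alpha,\beta)$-colouring exists; it has a gap if there are integers $k_1<k_2<k_3$ with $k_1,k_3$ in the spectrum and $k_2$ not. -}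

module Defs where

open import Data.Nat using (ℕ; zero; suc; _+_; _*_; _∸_; _≤_; _<_)
open import Data.Nat.DivMod using (_/_)
open import Data.Fin using (Fin)
open import Data.Fin.Subset using (Subset; ⁅_⁆; ⋃; ∣_∣; inside)
open import Data.Vec using (lookup)
open import Data.List using (List; map; filter; concatMap; length; allFin; []; _∷_)
open import Data.Nat.ListAction using (sum)
open import Data.List.Relation.Unary.All using (All)
open import Data.List.Membership.Propositional using (_∈_)
open import Data.List.Relation.Binary.Permutation.Propositional using (_↭_)
open import Data.Product using (Σ; _×_; ∃; ∃-syntax)
open import Relation.Binary.PropositionalEquality using (_≡_)
open import Relation.Nullary using (¬_; ¬?)
open import Relation.Nullary.Decidable using (does)
open import Data.Nat using (_≟_)
open import Data.Bool using (if_then_else_; not)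

-- floor division ⌊m/d⌋ (only ever used with d ≥ 1; value 0 for d = 0)
⌊_/_⌋ : ℕ → ℕ → ℕ
⌊ m / zero ⌋ = 0
⌊ m / suc d ⌋ = m / suc d

-- ceiling division ⌈m/d⌉ (only ever used with d ≥ 1; value 0 for d = 0)
⌈_/_⌉ : ℕ → ℕ → ℕ
⌈ m / zero ⌉ = 0
⌈ m / suc d ⌉ = (m + d) / suc d

-- A partition σ of r: a list of positive parts summing to r
-- (order of the list is irrelevant; everything below is invariant under permutation).
IsPartition : List ℕ → ℕ → Set
IsPartition σ r = All (1 ≤_) σ × sum σ ≡ r

-- Vertex set of H(n,r,q|σ): pairs (i , j), i : Fin n the class V_i, j : Fin q.
-- A subset K of the vertex set is given by its traces K i ⊆ V_i.
VSubset : ℕ → ℕ → Set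
VSubset n q = Fin n → Subset q

classSizes : ∀ {n q} → VSubset n q → List ℕ
classSizes {n} K = map (λ i → ∣ K i ∣) (allFin n)

nonzeroSizes : ∀ {n q} → VSubset n q → List ℕ
nonzeroSizes K = filter (λ m → ¬? (m ≟ 0)) (classSizes K)

IsEdge : ∀ (n r q : ℕ) (σ : List ℕ) → VSubset n q → Set
IsEdge n r q σ K = sum (classSizes K) ≡ r × nonzeroSizes K ↭ σ

Colouring : ℕ → ℕ → ℕ → Set
Colouring n q k = Fin n → Fin q → Fin k

coloursOn : ∀ {n q k} → Colouring n q k → VSubset n q → Subset k
coloursOn {n} {q} c K =
  ⋃ (concatMap (λ i → concatMap (λ j →
       if lookup (K i) j then ⁅ c i j ⁆ ∷ [] else [])
     (allFin q)) (allFin n))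

numColours : ∀ {n q k} → Colouring n q k → VSubset n q → ℕ
numColours c K = ∣ coloursOn c K ∣

-- a k-(α,β)-colouring of H(n,r,q|σ): uses exactly k colours (surjective onto Fin k)
-- and every edge receives at least α and at most β distinct colours
IsColouring : (n r q : ℕ) (σ : List ℕ) (α β k : ℕ) → Colouring n q k → Set
IsColouring n r q σ α β k c =
  (∀ (col : Fin k) → ∃[ i ] ∃[ j ] c i j ≡ col) ×
  (∀ (K : VSubset n q) → IsEdge n r q σ K →
     α ≤ numColours c K × numColours c K ≤ β)

HasColouring : (n r q : ℕ) (σ : List ℕ) (α β k : ℕ) → Set
HasColouring n r q σ α β k = Σ (Colouring n q k) (IsColouring n r q σ α β k)

SpectrumHasGap : (n r q : ℕ) (σ : List ℕ) (α β : ℕ) → Set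
SpectrumHasGap n r q σ α β =
  ∃[ k₁ ] ∃[ k₂ ] ∃[ k₃ ] (k₁ < k₂ × k₂ < k₃ ×
    HasColouring n r q σ α β k₁ × ¬ HasColouring n r q σ α β k₂ ×
    HasColouring n r q σ α β k₃)

-- The colourings: give the j-th vertex of every class the colour j mod β, resp. give every vertex
-- of class i the colour i mod k. As q = mβ + t with t < α − 1, any α − 1 residues mod β cover at
-- most (α − 1)m + t = Δ − 1 vertices of a class, so the part of size Δ of an edge sees α colours;
-- in the same way the s classes met by an edge take at least α residues mod k.
-- The non-existence results: call a class rich for a set T of at most α − 1 colours if at least Δ
-- of its vertices are coloured in T. Fewer than s classes are rich for the same T, since otherwise
-- some edge would be coloured inside T; so at most C(k, α − 1)(s − 1) classes are rich for some T.
-- A class rich for no T sees at least β colours, for otherwise its q vertices would number at most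
-- Δ − 1 + (β − α)m. With fewer than β colours every class is rich, which the bound on n forbids.
-- With β + 1 colours at least s classes see β colours each, and an edge through such classes is
-- chosen greedily so that it sees β + 1 colours: its part of size δ ≤ r − β goes to a class
-- carrying a colour missed by the class filled last.

module Submission where

open import Data.Bool using (true; false; if_then_else_)
open import Data.Empty using (⊥-elim)
open import Data.Fin using (Fin; zero; suc; toℕ; fromℕ<) renaming (_≟_ to _≟ᶠ_)
open import Data.Fin.Properties using (toℕ-fromℕ<; toℕ-injective; toℕ<n; injective⇒≤; any?)
  renaming (suc-injective to Fin-suc-injective)
open import Data.Fin.Subset
open import Data.Fin.Subset.Properties
open import Data.List as List using (List; []; _∷_; _++_; length; allFin; filter; concatMap)
open import Data.List.Properties using (length-map; length-tabulate; length-++; map-tabulate; map-∘; map-cong-local)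
open import Data.List.Membership.Propositional using (lose) renaming (_∈_ to _∈ₗ_)
open import Data.List.Membership.Propositional.Properties
open import Data.List.Membership.Propositional.Properties.WithK using (unique∧set⇒bag)
open import Data.List.Relation.Binary.BagAndSetEquality using (∼bag⇒↭)
open import Data.List.Relation.Binary.Permutation.Propositional using (_↭_; ↭-sym; ↭-trans; ↭-reflexive; module PermutationReasoning)
open import Data.List.Relation.Binary.Permutation.Propositional.Properties using (↭-length; ∈-resp-↭; map⁺; shift)
open import Data.List.Relation.Unary.All as All using (All)
open import Data.List.Relation.Unary.All.Properties using () renaming (map⁻ to All-map⁻)
import Data.List.Relation.Unary.Any as Any
open import Data.List.Relation.Unary.AllPairs using (_∷_)
open import Data.List.Relation.Unary.Unique.Propositional using (Unique)
import Data.List.Relation.Unary.Unique.Propositional.Properties as Unique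
open import Data.Nat using (ℕ; zero; suc; _+_; _*_; _∸_; _≤_; _<_; z≤n; s≤s; _≤?_; _<?_; NonZero; >-nonZero; >-nonZero⁻¹)
  renaming (_≟_ to _≟ℕ_)
open import Data.Nat.Combinatorics using (_C_; nC1≡n; nCk+nC[k+1]≡[n+1]C[k+1])
open import Data.Nat.DivMod
open import Data.Nat.ListAction using (sum)
open import Data.Nat.ListAction.Properties using (sum-↭)
open import Data.Nat.Properties
open import Data.Nat.Tactic.RingSolver using (solve-∀)
open import Data.Product using (∃-syntax; _×_; _,_; proj₁; proj₂)
open import Data.Sum as Sum using (_⊎_; inj₁; inj₂)
open import Data.Vec using ([]; _∷_; here; there; lookup; tabulate)
open import Data.Vec.Properties using (lookup∘tabulate; []=⇒lookup; lookup⇒[]=)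
open import Function.Bundles using (mk⇔)
open import Relation.Binary.PropositionalEquality
open import Relation.Nullary using (¬_; Dec; yes; no; does; ¬?)
open import Relation.Nullary.Decidable using (_×-dec_; dec-true)
open import Defs

-- Finite subsets

does-true⇒ : ∀ {P : Set} (P? : Dec P) → does P? ≡ true → P
does-true⇒ (yes p) _ = p

fromDec : ∀ {n} {P : Fin n → Set} → (∀ x → Dec (P x)) → Subset n
fromDec P? = tabulate (λ x → does (P? x))

∈-fromDec⁺ : ∀ {n} {P : Fin n → Set} (P? : ∀ x → Dec (P x)) {x} → P x → x ∈ fromDec P?
∈-fromDec⁺ P? {x} px = lookup⇒[]= x _ (trans (lookup∘tabulate _ x) (dec-true (P? x) px))

∈-fromDec⁻ : ∀ {n} {P : Fin n → Set} (P? : ∀ x → Dec (P x)) {x} → x ∈ fromDec P? → P x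
∈-fromDec⁻ P? {x} x∈ = does-true⇒ (P? x) (trans (sym (lookup∘tabulate _ x)) ([]=⇒lookup x∈))

∩⁺ : ∀ {n} {p q : Subset n} {x} → x ∈ p → x ∈ q → x ∈ p ∩ q
∩⁺ x∈p x∈q = x∈p∩q⁺ (x∈p , x∈q)

∩⁻ˡ : ∀ {n} {p q : Subset n} {x} → x ∈ p ∩ q → x ∈ p
∩⁻ˡ {p = p} {q} x∈ = proj₁ (x∈p∩q⁻ p q x∈)

∩⁻ʳ : ∀ {n} {p q : Subset n} {x} → x ∈ p ∩ q → x ∈ q
∩⁻ʳ {p = p} {q} x∈ = proj₂ (x∈p∩q⁻ p q x∈)

─⁺ : ∀ {n} {p q : Subset n} {x} → x ∈ p → x ∉ q → x ∈ p ─ q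
─⁺ = x∈p∧x∉q⇒x∈p─q

─⁻ˡ : ∀ {n} {p q : Subset n} {x} → x ∈ p ─ q → x ∈ p
─⁻ˡ {p = p} {q} x∈ = p─q⊆p p q x∈

─⁻ʳ : ∀ {n} {p q : Subset n} {x} → x ∈ p ─ q → x ∉ q
─⁻ʳ {p = inside ∷ p} {outside ∷ q} {zero} here ()
─⁻ʳ {p = _ ∷ p} {_ ∷ q} {suc x} (there x∈) (there x∈q) = ─⁻ʳ {p = p} {q} x∈ x∈q

∪-⊆ : ∀ {n} {p q r : Subset n} → p ⊆ r → q ⊆ r → p ∪ q ⊆ r
∪-⊆ {p = p} {q} p⊆r q⊆r x∈ = Sum.[ p⊆r , q⊆r ]′ (x∈p∪q⁻ p q x∈)

∈-⋃⁺ : ∀ {n} {x : Fin n} {p} (ps : List (Subset n)) → p ∈ₗ ps → x ∈ p → x ∈ ⋃ ps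
∈-⋃⁺ (p ∷ ps) (Any.here refl) x∈p = x∈p∪q⁺ (inj₁ x∈p)
∈-⋃⁺ (p ∷ ps) (Any.there p∈) x∈p = x∈p∪q⁺ (inj₂ (∈-⋃⁺ ps p∈ x∈p))

∈-⋃⁻ : ∀ {n} {x : Fin n} (ps : List (Subset n)) → x ∈ ⋃ ps → ∃[ p ] p ∈ₗ ps × x ∈ p
∈-⋃⁻ [] x∈ = ⊥-elim (∉⊥ x∈)
∈-⋃⁻ (p ∷ ps) x∈ with x∈p∪q⁻ p (⋃ ps) x∈
... | inj₁ x∈p = p , Any.here refl , x∈p
... | inj₂ x∈ps = let (p′ , p′∈ , x∈p′) = ∈-⋃⁻ ps x∈ps in p′ , Any.there p′∈ , x∈p′

x∈p⇒1≤∣p∣ : ∀ {n} {p : Subset n} {x} → x ∈ p → 1 ≤ ∣ p ∣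
x∈p⇒1≤∣p∣ {p = p} {x} x∈p = ≤-trans (≤-reflexive (sym (∣⁅x⁆∣≡1 x)))
  (p⊆q⇒∣p∣≤∣q∣ (λ y∈ → subst (_∈ p) (sym (x∈⁅y⁆⇒x≡y x y∈)) x∈p))

1≤∣p∣⇒nonempty : ∀ {n} (p : Subset n) → 1 ≤ ∣ p ∣ → Nonempty p
1≤∣p∣⇒nonempty {n} p 1≤∣p∣ with nonempty? p
... | yes ne = ne
... | no ¬ne = ⊥-elim (1+n≰n (≤-trans 1≤∣p∣
  (≤-trans (p⊆q⇒∣p∣≤∣q∣ {q = ⊥} (λ {x} x∈p → ⊥-elim (¬ne (x , x∈p)))) (≤-reflexive (∣⊥∣≡0 n)))))

⊆⊇⇒∣p∣≡∣q∣ : ∀ {n} (p q : Subset n) → p ⊆ q → q ⊆ p → ∣ p ∣ ≡ ∣ q ∣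
⊆⊇⇒∣p∣≡∣q∣ _ _ p⊆q q⊆p = ≤-antisym (p⊆q⇒∣p∣≤∣q∣ p⊆q) (p⊆q⇒∣p∣≤∣q∣ q⊆p)

∣p∪q∣+∣p∩q∣≡∣p∣+∣q∣ : ∀ {n} (p q : Subset n) → ∣ p ∪ q ∣ + ∣ p ∩ q ∣ ≡ ∣ p ∣ + ∣ q ∣
∣p∪q∣+∣p∩q∣≡∣p∣+∣q∣ [] [] = refl
∣p∪q∣+∣p∩q∣≡∣p∣+∣q∣ (inside ∷ p) (inside ∷ q) = cong suc (begin
  ∣ p ∪ q ∣ + suc ∣ p ∩ q ∣ ≡⟨ +-suc ∣ p ∪ q ∣ ∣ p ∩ q ∣ ⟩
  suc (∣ p ∪ q ∣ + ∣ p ∩ q ∣) ≡⟨ cong suc (∣p∪q∣+∣p∩q∣≡∣p∣+∣q∣ p q) ⟩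
  suc (∣ p ∣ + ∣ q ∣) ≡⟨ +-suc ∣ p ∣ ∣ q ∣ ⟨
  ∣ p ∣ + suc ∣ q ∣ ∎)
  where open ≡-Reasoning
∣p∪q∣+∣p∩q∣≡∣p∣+∣q∣ (inside ∷ p) (outside ∷ q) = cong suc (∣p∪q∣+∣p∩q∣≡∣p∣+∣q∣ p q)
∣p∪q∣+∣p∩q∣≡∣p∣+∣q∣ (outside ∷ p) (inside ∷ q) =
  trans (cong suc (∣p∪q∣+∣p∩q∣≡∣p∣+∣q∣ p q)) (sym (+-suc ∣ p ∣ ∣ q ∣))
∣p∪q∣+∣p∩q∣≡∣p∣+∣q∣ (outside ∷ p) (outside ∷ q) = ∣p∪q∣+∣p∩q∣≡∣p∣+∣q∣ p q

∣p∪q∣≤∣p∣+∣q∣ : ∀ {n} (p q : Subset n) → ∣ p ∪ q ∣ ≤ ∣ p ∣ + ∣ q ∣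
∣p∪q∣≤∣p∣+∣q∣ p q = ≤-trans (m≤m+n ∣ p ∪ q ∣ ∣ p ∩ q ∣) (≤-reflexive (∣p∪q∣+∣p∩q∣≡∣p∣+∣q∣ p q))

disjoint⇒∣p∪q∣≡∣p∣+∣q∣ : ∀ {n} (p q : Subset n) → (∀ {x} → x ∈ p → x ∉ q) →
  ∣ p ∪ q ∣ ≡ ∣ p ∣ + ∣ q ∣
disjoint⇒∣p∪q∣≡∣p∣+∣q∣ {n} p q disj = begin
  ∣ p ∪ q ∣              ≡⟨ +-identityʳ _ ⟨
  ∣ p ∪ q ∣ + 0          ≡⟨ cong (∣ p ∪ q ∣ +_) ∣p∩q∣≡0 ⟨
  ∣ p ∪ q ∣ + ∣ p ∩ q ∣  ≡⟨ ∣p∪q∣+∣p∩q∣≡∣p∣+∣q∣ p q ⟩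
  ∣ p ∣ + ∣ q ∣          ∎
  where
  open ≡-Reasoning
  ∣p∩q∣≡0 : ∣ p ∩ q ∣ ≡ 0
  ∣p∩q∣≡0 = n≤0⇒n≡0 (≤-trans (p⊆q⇒∣p∣≤∣q∣ {q = ⊥} (λ x∈ → ⊥-elim (disj (∩⁻ˡ x∈) (∩⁻ʳ x∈))))
                              (≤-reflexive (∣⊥∣≡0 n)))

∣p∣≡∣p∩q∣+∣p─q∣ : ∀ {n} (p q : Subset n) → ∣ p ∣ ≡ ∣ p ∩ q ∣ + ∣ p ─ q ∣
∣p∣≡∣p∩q∣+∣p─q∣ [] [] = refl
∣p∣≡∣p∩q∣+∣p─q∣ (inside ∷ p) (inside ∷ q) = cong suc (∣p∣≡∣p∩q∣+∣p─q∣ p q)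
∣p∣≡∣p∩q∣+∣p─q∣ (inside ∷ p) (outside ∷ q) =
  trans (cong suc (∣p∣≡∣p∩q∣+∣p─q∣ p q)) (sym (+-suc ∣ p ∩ q ∣ ∣ p ─ q ∣))
∣p∣≡∣p∩q∣+∣p─q∣ (outside ∷ p) (inside ∷ q) = ∣p∣≡∣p∩q∣+∣p─q∣ p q
∣p∣≡∣p∩q∣+∣p─q∣ (outside ∷ p) (outside ∷ q) = ∣p∣≡∣p∩q∣+∣p─q∣ p q

x∈p⇒∣p∣≡1+∣p-x∣ : ∀ {n} (p : Subset n) {x} → x ∈ p → ∣ p ∣ ≡ suc ∣ p - x ∣
x∈p⇒∣p∣≡1+∣p-x∣ p {x} x∈p = trans (∣p∣≡∣p∩q∣+∣p─q∣ p ⁅ x ⁆) (cong (_+ ∣ p - x ∣) ∣p∩⁅x⁆∣≡1)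
  where
  ∣p∩⁅x⁆∣≡1 : ∣ p ∩ ⁅ x ⁆ ∣ ≡ 1
  ∣p∩⁅x⁆∣≡1 = trans (⊆⊇⇒∣p∣≡∣q∣ (p ∩ ⁅ x ⁆) ⁅ x ⁆ ∩⁻ʳ (λ y∈ → ∩⁺ (subst (_∈ p) (sym (x∈⁅y⁆⇒x≡y x y∈)) x∈p) y∈))
                    (∣⁅x⁆∣≡1 x)

∣p∣≤1+∣p-x∣ : ∀ {n} (p : Subset n) x → ∣ p ∣ ≤ suc ∣ p - x ∣
∣p∣≤1+∣p-x∣ p x = ≤-trans (≤-reflexive (∣p∣≡∣p∩q∣+∣p─q∣ p ⁅ x ⁆))
  (+-monoˡ-≤ ∣ p - x ∣ (≤-trans (∣p∩q∣≤∣q∣ p ⁅ x ⁆) (≤-reflexive (∣⁅x⁆∣≡1 x))))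

∣⋃ps∣≤length*b : ∀ {n} (ps : List (Subset n)) (b : ℕ) → (∀ {p} → p ∈ₗ ps → ∣ p ∣ ≤ b) →
  ∣ ⋃ ps ∣ ≤ length ps * b
∣⋃ps∣≤length*b {n} [] b _ = ≤-reflexive (∣⊥∣≡0 n)
∣⋃ps∣≤length*b (p ∷ ps) b bound = ≤-trans (∣p∪q∣≤∣p∣+∣q∣ p (⋃ ps))
  (+-mono-≤ (bound (Any.here refl)) (∣⋃ps∣≤length*b ps b (λ p∈ → bound (Any.there p∈))))

enumerate : ∀ {n} (p : Subset n) → Fin ∣ p ∣ → Fin n
enumerate (inside ∷ p) zero = zero
enumerate (inside ∷ p) (suc u) = suc (enumerate p u)
enumerate (outside ∷ p) u = suc (enumerate p u)

enumerate-∈ : ∀ {n} (p : Subset n) u → enumerate p u ∈ p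
enumerate-∈ (inside ∷ p) zero = here
enumerate-∈ (inside ∷ p) (suc u) = there (enumerate-∈ p u)
enumerate-∈ (outside ∷ p) u = there (enumerate-∈ p u)

enumerate-injective : ∀ {n} (p : Subset n) {u v} → enumerate p u ≡ enumerate p v → u ≡ v
enumerate-injective (inside ∷ p) {zero} {zero} _ = refl
enumerate-injective (inside ∷ p) {suc u} {suc v} eq =
  cong suc (enumerate-injective p (Fin-suc-injective eq))
enumerate-injective (outside ∷ p) eq = enumerate-injective p (Fin-suc-injective eq)

enumerate-surjective : ∀ {n} (p : Subset n) {x} → x ∈ p → ∃[ u ] enumerate p u ≡ x
enumerate-surjective (inside ∷ p) here = zero , refl
enumerate-surjective (inside ∷ p) (there x∈p) =
  let (u , eq) = enumerate-surjective p x∈p in suc u , cong suc eq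
enumerate-surjective (outside ∷ p) (there x∈p) =
  let (u , eq) = enumerate-surjective p x∈p in u , cong suc eq

injection⇒∣p∣≤∣q∣ : ∀ {m n} {p : Subset m} {q : Subset n} (f : ∀ x → x ∈ p → Fin n) →
  (∀ {x} (x∈p : x ∈ p) → f x x∈p ∈ q) →
  (∀ {x y} (x∈p : x ∈ p) (y∈p : y ∈ p) → f x x∈p ≡ f y y∈p → x ≡ y) → ∣ p ∣ ≤ ∣ q ∣
injection⇒∣p∣≤∣q∣ {p = p} {q} f f∈q f-inj = injective⇒≤ {f = g} g-injective
  where
  g : Fin ∣ p ∣ → Fin ∣ q ∣
  g u = proj₁ (enumerate-surjective q (f∈q (enumerate-∈ p u)))
  enumerate∘g : ∀ u → enumerate q (g u) ≡ f _ (enumerate-∈ p u)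
  enumerate∘g u = proj₂ (enumerate-surjective q (f∈q (enumerate-∈ p u)))
  g-injective : ∀ {u v} → g u ≡ g v → u ≡ v
  g-injective {u} {v} eq = enumerate-injective p (f-inj (enumerate-∈ p u) (enumerate-∈ p v)
    (trans (sym (enumerate∘g u)) (trans (cong (enumerate q) eq) (enumerate∘g v))))

injection⇒∣p∣≤m : ∀ {n m} {p : Subset n} (f : ∀ x → x ∈ p → Fin m) →
  (∀ {x y} (x∈p : x ∈ p) (y∈p : y ∈ p) → f x x∈p ≡ f y y∈p → x ≡ y) → ∣ p ∣ ≤ m
injection⇒∣p∣≤m {m = m} f f-inj =
  ≤-trans (injection⇒∣p∣≤∣q∣ {q = ⊤} f (λ _ → ∈⊤) f-inj) (≤-reflexive (∣⊤∣≡n m))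

opaque
  subset-between : ∀ {n} (p r : Subset n) (k : ℕ) → p ⊆ r → ∣ p ∣ ≤ k → k ≤ ∣ r ∣ →
    ∃[ q ] p ⊆ q × q ⊆ r × ∣ q ∣ ≡ k
  subset-between [] [] zero _ _ _ = [] , (λ ()) , (λ ()) , refl
  subset-between (inside ∷ p) (outside ∷ r) k p⊆r _ _ with p⊆r here
  ... | ()
  subset-between (outside ∷ p) (outside ∷ r) k p⊆r p≤k k≤r =
    let (q , p⊆q , q⊆r , ∣q∣≡k) = subset-between p r k (drop-∷-⊆ p⊆r) p≤k k≤r
    in outside ∷ q , s⊆s p⊆q , s⊆s q⊆r , ∣q∣≡k
  subset-between (inside ∷ p) (inside ∷ r) (suc k) p⊆r (s≤s p≤k) (s≤s k≤r) =
    let (q , p⊆q , q⊆r , ∣q∣≡k) = subset-between p r k (drop-∷-⊆ p⊆r) p≤k k≤r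
    in inside ∷ q , s⊆s p⊆q , s⊆s q⊆r , cong suc ∣q∣≡k
  subset-between (outside ∷ p) (inside ∷ r) k p⊆r p≤k k≤1+r with k ≤? ∣ r ∣
  ... | yes k≤r =
    let (q , p⊆q , q⊆r , ∣q∣≡k) = subset-between p r k (drop-∷-⊆ p⊆r) p≤k k≤r
    in outside ∷ q , s⊆s p⊆q , out⊆ q⊆r , ∣q∣≡k
  subset-between (outside ∷ p) (inside ∷ r) (suc k) p⊆r p≤k (s≤s k≤r) | no k≰r =
    let (q , p⊆q , q⊆r , ∣q∣≡k) = subset-between p r k (drop-∷-⊆ p⊆r)
          (≤-trans (p⊆q⇒∣p∣≤∣q∣ (drop-∷-⊆ p⊆r)) (≮⇒≥ k≰r)) k≤r
    in inside ∷ q , out⊆ p⊆q , s⊆s q⊆r , cong suc ∣q∣≡k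
  subset-between (outside ∷ p) (inside ∷ r) zero _ _ _ | no 0≰r = ⊥-elim (0≰r z≤n)

  subset-of-size : ∀ {n} (r : Subset n) (k : ℕ) → k ≤ ∣ r ∣ → ∃[ q ] q ⊆ r × ∣ q ∣ ≡ k
  subset-of-size {n} r k k≤r =
    let (q , _ , q⊆r , ∣q∣≡k) = subset-between ⊥ r k (λ x∈ → ⊥-elim (∉⊥ x∈))
                                   (≤-trans (≤-reflexive (∣⊥∣≡0 n)) z≤n) k≤r
    in q , q⊆r , ∣q∣≡k

  choose : ∀ {n} → Subset n → ℕ → Subset n
  choose r k with k ≤? ∣ r ∣
  ... | yes k≤r = proj₁ (subset-of-size r k k≤r)
  ... | no _ = ⊥

  choose-⊆ : ∀ {n} (r : Subset n) k → k ≤ ∣ r ∣ → choose r k ⊆ r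
  choose-⊆ r k k≤r with k ≤? ∣ r ∣
  ... | yes k≤r = proj₁ (proj₂ (subset-of-size r k k≤r))
  ... | no k≰r = ⊥-elim (k≰r k≤r)

  ∣choose∣≡k : ∀ {n} (r : Subset n) k → k ≤ ∣ r ∣ → ∣ choose r k ∣ ≡ k
  ∣choose∣≡k r k k≤r with k ≤? ∣ r ∣
  ... | yes k≤r = proj₂ (proj₂ (subset-of-size r k k≤r))
  ... | no k≰r = ⊥-elim (k≰r k≤r)

preimage : ∀ {m n} → (Fin m → Fin n) → Subset n → Subset m
preimage h T = fromDec (λ x → h x ∈? T)

image : ∀ {m n} → (Fin m → Fin n) → Subset m → Subset n
image h X = fromDec (λ y → any? (λ x → (x ∈? X) ×-dec (h x ≟ᶠ y)))

∈-preimage⁺ : ∀ {m n} (h : Fin m → Fin n) T {x} → h x ∈ T → x ∈ preimage h T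
∈-preimage⁺ h T = ∈-fromDec⁺ (λ x → h x ∈? T)

∈-preimage⁻ : ∀ {m n} (h : Fin m → Fin n) T {x} → x ∈ preimage h T → h x ∈ T
∈-preimage⁻ h T = ∈-fromDec⁻ (λ x → h x ∈? T)

preimage-mono : ∀ {m n} (h : Fin m → Fin n) {S T} → S ⊆ T → preimage h S ⊆ preimage h T
preimage-mono h {S} {T} S⊆T x∈ = ∈-preimage⁺ h T (S⊆T (∈-preimage⁻ h S x∈))

∈-image⁺ : ∀ {m n} (h : Fin m → Fin n) {X x} → x ∈ X → h x ∈ image h X
∈-image⁺ h {X} {x} x∈X = ∈-fromDec⁺ (λ y → any? (λ x → (x ∈? X) ×-dec (h x ≟ᶠ y))) (x , x∈X , refl)

∈-image⁻ : ∀ {m n} (h : Fin m → Fin n) {X y} → y ∈ image h X → ∃[ x ] x ∈ X × h x ≡ y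
∈-image⁻ h {X} = ∈-fromDec⁻ (λ y → any? (λ x → (x ∈? X) ×-dec (h x ≟ᶠ y)))

⊆-preimage-image : ∀ {m n} (h : Fin m → Fin n) X → X ⊆ preimage h (image h X)
⊆-preimage-image h X x∈X = ∈-preimage⁺ h (image h X) (∈-image⁺ h x∈X)

∣image∣≤∣X∣ : ∀ {m n} (h : Fin m → Fin n) X → ∣ image h X ∣ ≤ ∣ X ∣
∣image∣≤∣X∣ h X = injection⇒∣p∣≤∣q∣ (λ y y∈ → proj₁ (∈-image⁻ h y∈)) (λ y∈ → proj₁ (proj₂ (∈-image⁻ h y∈)))
  (λ y∈ y′∈ eq → trans (sym (proj₂ (proj₂ (∈-image⁻ h y∈))))
                       (trans (cong h eq) (proj₂ (proj₂ (∈-image⁻ h y′∈)))))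

module _ {m n} (h : Fin m → Fin n) (Y : Subset m) where

  ∣Y∩preimage∣-split : ∀ T S →
    ∣ Y ∩ preimage h T ∣ ≡ ∣ Y ∩ preimage h (T ∩ S) ∣ + ∣ Y ∩ preimage h (T ─ S) ∣
  ∣Y∩preimage∣-split T S =
    trans (∣p∣≡∣p∩q∣+∣p─q∣ (Y ∩ preimage h T) (preimage h S)) (cong₂ _+_ inside-S outside-S)
    where
    inside-S : ∣ (Y ∩ preimage h T) ∩ preimage h S ∣ ≡ ∣ Y ∩ preimage h (T ∩ S) ∣
    inside-S = ⊆⊇⇒∣p∣≡∣q∣ _ (Y ∩ preimage h (T ∩ S))
      (λ x∈ → ∩⁺ (∩⁻ˡ (∩⁻ˡ x∈)) (∈-preimage⁺ h (T ∩ S)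
                (∩⁺ (∈-preimage⁻ h T (∩⁻ʳ (∩⁻ˡ x∈))) (∈-preimage⁻ h S (∩⁻ʳ x∈)))))
      (λ x∈ → let hx∈ = ∈-preimage⁻ h (T ∩ S) (∩⁻ʳ x∈) in
              ∩⁺ (∩⁺ (∩⁻ˡ x∈) (∈-preimage⁺ h T (∩⁻ˡ hx∈))) (∈-preimage⁺ h S (∩⁻ʳ hx∈)))
    outside-S : ∣ (Y ∩ preimage h T) ─ preimage h S ∣ ≡ ∣ Y ∩ preimage h (T ─ S) ∣
    outside-S = ⊆⊇⇒∣p∣≡∣q∣ _ (Y ∩ preimage h (T ─ S))
      (λ x∈ → ∩⁺ (∩⁻ˡ (─⁻ˡ x∈)) (∈-preimage⁺ h (T ─ S)
                (─⁺ (∈-preimage⁻ h T (∩⁻ʳ (─⁻ˡ x∈))) (λ hx∈S → ─⁻ʳ x∈ (∈-preimage⁺ h S hx∈S)))))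
      (λ x∈ → let hx∈ = ∈-preimage⁻ h (T ─ S) (∩⁻ʳ x∈) in
              ─⁺ (∩⁺ (∩⁻ˡ x∈) (∈-preimage⁺ h T (─⁻ˡ hx∈))) (λ x∈S → ─⁻ʳ hx∈ (∈-preimage⁻ h S x∈S)))

  ∣Y∩preimage∣-remove : ∀ T {z} → z ∈ T →
    ∣ Y ∩ preimage h T ∣ ≡ ∣ Y ∩ preimage h ⁅ z ⁆ ∣ + ∣ Y ∩ preimage h (T - z) ∣
  ∣Y∩preimage∣-remove T {z} z∈T =
    trans (∣Y∩preimage∣-split T ⁅ z ⁆) (cong (_+ ∣ Y ∩ preimage h (T - z) ∣) (⊆⊇⇒∣p∣≡∣q∣ (Y ∩ preimage h (T ∩ ⁅ z ⁆)) (Y ∩ preimage h ⁅ z ⁆)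
      (λ x∈ → ∩⁺ (∩⁻ˡ x∈) (∈-preimage⁺ h ⁅ z ⁆ (∩⁻ʳ (∈-preimage⁻ h (T ∩ ⁅ z ⁆) (∩⁻ʳ x∈)))))
      (λ {x} x∈ → let hx≡z = x∈⁅y⁆⇒x≡y z (∈-preimage⁻ h ⁅ z ⁆ (∩⁻ʳ x∈)) in
        ∩⁺ (∩⁻ˡ x∈) (∈-preimage⁺ h (T ∩ ⁅ z ⁆)
          (∩⁺ (subst (_∈ T) (sym hx≡z) z∈T) (∈-preimage⁻ h ⁅ z ⁆ (∩⁻ʳ x∈)))))))

  preimage-lower-bound : ∀ e (T : Subset n) → (∀ {z} → z ∈ T → e ≤ ∣ Y ∩ preimage h ⁅ z ⁆ ∣) →
    ∣ T ∣ * e ≤ ∣ Y ∩ preimage h T ∣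
  preimage-lower-bound e T = go ∣ T ∣ T refl
    where
    go : ∀ t T → ∣ T ∣ ≡ t → (∀ {z} → z ∈ T → e ≤ ∣ Y ∩ preimage h ⁅ z ⁆ ∣) →
      t * e ≤ ∣ Y ∩ preimage h T ∣
    go zero T _ _ = z≤n
    go (suc t) T ∣T∣≡1+t bound with 1≤∣p∣⇒nonempty T (subst (1 ≤_) (sym ∣T∣≡1+t) (s≤s z≤n))
    ... | (z , z∈T) = subst (suc t * e ≤_) (sym (∣Y∩preimage∣-remove T z∈T))
      (+-mono-≤ (bound z∈T) (go t (T - z) (suc-injective (trans (sym (x∈p⇒∣p∣≡1+∣p-x∣ T z∈T)) ∣T∣≡1+t))
                                 (λ z′∈ → bound (─⁻ˡ z′∈))))

  preimage-upper-bound : ∀ u (T : Subset n) → (∀ {z} → z ∈ T → ∣ Y ∩ preimage h ⁅ z ⁆ ∣ ≤ u) →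
    ∣ Y ∩ preimage h T ∣ ≤ ∣ T ∣ * u
  preimage-upper-bound u T = go ∣ T ∣ T refl
    where
    go : ∀ t T → ∣ T ∣ ≡ t → (∀ {z} → z ∈ T → ∣ Y ∩ preimage h ⁅ z ⁆ ∣ ≤ u) →
      ∣ Y ∩ preimage h T ∣ ≤ t * u
    go zero T ∣T∣≡0 _ = ≤-trans (p⊆q⇒∣p∣≤∣q∣ {q = ⊥} T-empty) (≤-reflexive (∣⊥∣≡0 m))
      where
      T-empty : Y ∩ preimage h T ⊆ ⊥
      T-empty x∈ = ⊥-elim (1+n≰n (≤-trans (x∈p⇒1≤∣p∣ (∈-preimage⁻ h T (∩⁻ʳ x∈))) (≤-reflexive ∣T∣≡0)))
    go (suc t) T ∣T∣≡1+t bound with 1≤∣p∣⇒nonempty T (subst (1 ≤_) (sym ∣T∣≡1+t) (s≤s z≤n))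
    ... | (z , z∈T) = subst (_≤ suc t * u) (sym (∣Y∩preimage∣-remove T z∈T))
      (+-mono-≤ (bound z∈T) (go t (T - z) (suc-injective (trans (sym (x∈p⇒∣p∣≡1+∣p-x∣ T z∈T)) ∣T∣≡1+t))
                                 (λ z′∈ → bound (─⁻ˡ z′∈))))

  preimage-upper-bound-mixed : ∀ u (V T : Subset n) →
    (∀ {z} → z ∈ T → z ∈ V → ∣ Y ∩ preimage h ⁅ z ⁆ ∣ ≤ suc u) →
    (∀ {z} → z ∈ T → z ∉ V → ∣ Y ∩ preimage h ⁅ z ⁆ ∣ ≤ u) →
    ∣ Y ∩ preimage h T ∣ ≤ ∣ T ∣ * u + ∣ T ∩ V ∣
  preimage-upper-bound-mixed u V T bound-V bound-∁V = begin
    ∣ Y ∩ preimage h T ∣                                   ≡⟨ ∣Y∩preimage∣-split T V ⟩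
    ∣ Y ∩ preimage h (T ∩ V) ∣ + ∣ Y ∩ preimage h (T ─ V) ∣
      ≤⟨ +-mono-≤ (preimage-upper-bound (suc u) (T ∩ V) (λ z∈ → bound-V (∩⁻ˡ z∈) (∩⁻ʳ z∈)))
                  (preimage-upper-bound u (T ─ V) (λ z∈ → bound-∁V (─⁻ˡ z∈) (─⁻ʳ z∈))) ⟩
    ∣ T ∩ V ∣ * suc u + ∣ T ─ V ∣ * u                       ≡⟨ rearrange ∣ T ∩ V ∣ ∣ T ─ V ∣ u ⟩
    (∣ T ∩ V ∣ + ∣ T ─ V ∣) * u + ∣ T ∩ V ∣               ≡⟨ cong (λ t → t * u + ∣ T ∩ V ∣) (∣p∣≡∣p∩q∣+∣p─q∣ T V) ⟨
    ∣ T ∣ * u + ∣ T ∩ V ∣                                  ∎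
    where
    open ≤-Reasoning
    rearrange : ∀ a b u → a * suc u + b * u ≡ (a + b) * u + a
    rearrange = solve-∀

module _ {m n} (h : Fin m → Fin n) (a D M : ℕ) (D<a*[1+M] : D < a * suc M) where

  small-colour-class : (X : Subset m) → a ≤ ∣ image h X ∣ →
    (∀ T → ∣ T ∣ ≤ a → ∣ X ∩ preimage h T ∣ ≤ D) →
    ∃[ z ] z ∈ image h X × ∣ X ∩ preimage h ⁅ z ⁆ ∣ ≤ M
  small-colour-class X a≤∣image∣ bound
    with subset-of-size (image h X) a a≤∣image∣
  ... | (T , T⊆image , ∣T∣≡a)
    with any? (λ z → (z ∈? T) ×-dec (∣ X ∩ preimage h ⁅ z ⁆ ∣ ≤? M))
  ... | yes (z , z∈T , small) = z , T⊆image z∈T , small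
  ... | no none = ⊥-elim (<⇒≱ D<a*[1+M] (begin
    a * suc M                   ≡⟨ cong (_* suc M) ∣T∣≡a ⟨
    ∣ T ∣ * suc M               ≤⟨ preimage-lower-bound h X (suc M) T
                                     (λ {z} z∈T → ≰⇒> (λ small → none (z , z∈T , small))) ⟩
    ∣ X ∩ preimage h T ∣        ≤⟨ bound T (≤-reflexive ∣T∣≡a) ⟩
    D                           ∎))
    where open ≤-Reasoning

  few-colours⇒∣X∣≤D+b*M : ∀ b (X : Subset m) → ∣ image h X ∣ ≤ a + b →
    (∀ T → ∣ T ∣ ≤ a → ∣ X ∩ preimage h T ∣ ≤ D) → ∣ X ∣ ≤ D + b * M
  few-colours⇒∣X∣≤D+b*M zero X ∣image∣≤a bound = begin
    ∣ X ∣                               ≤⟨ p⊆q⇒∣p∣≤∣q∣ (λ x∈ → ∩⁺ x∈ (⊆-preimage-image h X x∈)) ⟩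
    ∣ X ∩ preimage h (image h X) ∣      ≤⟨ bound (image h X) (subst (∣ image h X ∣ ≤_) (+-identityʳ a) ∣image∣≤a) ⟩
    D                                   ≤⟨ m≤m+n D 0 ⟩
    D + 0 * M                           ∎
    where open ≤-Reasoning
  few-colours⇒∣X∣≤D+b*M (suc b) X ∣image∣≤a+1+b bound with ∣ image h X ∣ ≤? a + b
  ... | yes ∣image∣≤a+b =
    ≤-trans (few-colours⇒∣X∣≤D+b*M b X ∣image∣≤a+b bound) (+-monoʳ-≤ D (*-monoˡ-≤ M (n≤1+n b)))
  ... | no ∣image∣≰a+b with small-colour-class X (≤-trans (m≤m+n a b) (<⇒≤ (≰⇒> ∣image∣≰a+b))) bound
  ... | (z , z∈image , small) = begin
    ∣ X ∣                                        ≡⟨ ∣p∣≡∣p∩q∣+∣p─q∣ X (preimage h ⁅ z ⁆) ⟩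
    ∣ X ∩ preimage h ⁅ z ⁆ ∣ + ∣ X′ ∣            ≤⟨ +-mono-≤ small (few-colours⇒∣X∣≤D+b*M b X′ ∣image′∣≤a+b bound′) ⟩
    M + (D + b * M)                              ≡⟨ rearrange M D b ⟩
    D + suc b * M                                ∎
    where
    open ≤-Reasoning
    X′ = X ─ preimage h ⁅ z ⁆
    image′⊆ : image h X′ ⊆ image h X - z
    image′⊆ y∈ with ∈-image⁻ h y∈
    ... | (x , x∈X′ , refl) = ─⁺ (∈-image⁺ h (─⁻ˡ x∈X′)) (λ hx∈ → ─⁻ʳ x∈X′ (∈-preimage⁺ h ⁅ z ⁆ hx∈))
    ∣image′∣≤a+b : ∣ image h X′ ∣ ≤ a + b
    ∣image′∣≤a+b = ≤-trans (p⊆q⇒∣p∣≤∣q∣ image′⊆) (≤-pred (begin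
      suc ∣ image h X - z ∣   ≡⟨ x∈p⇒∣p∣≡1+∣p-x∣ (image h X) z∈image ⟨
      ∣ image h X ∣           ≤⟨ ∣image∣≤a+1+b ⟩
      a + suc b               ≡⟨ +-suc a b ⟩
      suc (a + b)             ∎))
    bound′ : ∀ T → ∣ T ∣ ≤ a → ∣ X′ ∩ preimage h T ∣ ≤ D
    bound′ T ∣T∣≤a = ≤-trans (p⊆q⇒∣p∣≤∣q∣ {p = X′ ∩ preimage h T} (λ x∈ → ∩⁺ (─⁻ˡ (∩⁻ˡ x∈)) (∩⁻ʳ x∈)))
                             (bound T ∣T∣≤a)
    rearrange : ∀ M D b → M + (D + b * M) ≡ D + suc b * M
    rearrange = solve-∀

-- Colouring by residues

module _ (k : ℕ) .{{_ : NonZero k}} where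

  residue : ∀ {N} → Fin N → Fin k
  residue j = toℕ j mod k

  toℕ-residue : ∀ {N} (j : Fin N) → toℕ j ≡ toℕ (residue j) + (toℕ j / k) * k
  toℕ-residue j = trans (m≡m%n+[m/n]*n (toℕ j) k) (cong (_+ (toℕ j / k) * k) (sym (toℕ-fromℕ< _)))

  residue-surjective : ∀ {N} → k ≤ N → (c : Fin k) → ∃[ j ] residue {N} j ≡ c
  residue-surjective k≤N c = fromℕ< c<N , toℕ-injective (begin
    toℕ (residue (fromℕ< c<N))  ≡⟨ toℕ-fromℕ< _ ⟩
    toℕ (fromℕ< c<N) % k        ≡⟨ cong (_% k) (toℕ-fromℕ< c<N) ⟩
    toℕ c % k                   ≡⟨ m<n⇒m%n≡m (toℕ<n c) ⟩
    toℕ c                       ∎)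
    where
    open ≡-Reasoning
    c<N = <-≤-trans (toℕ<n c) k≤N

  ∣residue-fibre∣≤ : ∀ {N} (c : Fin k) M → (∀ (j : Fin N) → residue j ≡ c → toℕ j / k < M) →
    ∣ ⊤ ∩ preimage (residue {N}) ⁅ c ⁆ ∣ ≤ M
  ∣residue-fibre∣≤ {N} c M bound = injection⇒∣p∣≤m f f-injective
    where
    residue≡c : ∀ {j} → j ∈ ⊤ ∩ preimage (residue {N}) ⁅ c ⁆ → residue j ≡ c
    residue≡c j∈ = x∈⁅y⁆⇒x≡y c (∈-preimage⁻ residue ⁅ c ⁆ (∩⁻ʳ j∈))
    f : ∀ j → j ∈ ⊤ ∩ preimage (residue {N}) ⁅ c ⁆ → Fin M
    f j j∈ = fromℕ< (bound j (residue≡c j∈))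
    f-injective : ∀ {x y} x∈ y∈ → f x x∈ ≡ f y y∈ → x ≡ y
    f-injective {x} {y} x∈ y∈ eq = toℕ-injective (begin
      toℕ x                                ≡⟨ toℕ-residue x ⟩
      toℕ (residue x) + (toℕ x / k) * k    ≡⟨ cong₂ (λ r d → toℕ r + d * k)
                                                 (trans (residue≡c x∈) (sym (residue≡c y∈))) quotients≡ ⟩
      toℕ (residue y) + (toℕ y / k) * k    ≡⟨ toℕ-residue y ⟨
      toℕ y                                ∎)
      where
      open ≡-Reasoning
      quotients≡ : toℕ x / k ≡ toℕ y / k
      quotients≡ = trans (sym (toℕ-fromℕ< _)) (trans (cong toℕ eq) (toℕ-fromℕ< _))

  -- Below N ≤ u k + v, the residues < v occur u + 1 times and the others u times.
  ∣preimage-residue∣≤ : ∀ {N} u v → N ≤ u * k + v → v ≤ k →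
    ∀ a (T : Subset k) → ∣ T ∣ ≤ a → ∣ preimage (residue {N}) T ∣ ≤ a * u + v
  ∣preimage-residue∣≤ {N} u v N≤uk+v v≤k a T ∣T∣≤a = begin
    ∣ preimage (residue {N}) T ∣                ≤⟨ p⊆q⇒∣p∣≤∣q∣ {q = ⊤ ∩ preimage (residue {N}) T} (λ j∈ → ∩⁺ ∈⊤ j∈) ⟩
    ∣ ⊤ ∩ preimage (residue {N}) T ∣            ≤⟨ preimage-upper-bound-mixed (residue {N}) ⊤ u V T
                                               (λ _ c∈V → fibre-small c∈V) (λ _ c∉V → fibre-large c∉V) ⟩
    ∣ T ∣ * u + ∣ T ∩ V ∣                 ≤⟨ +-mono-≤ (*-monoˡ-≤ u ∣T∣≤a) (≤-trans (∣p∩q∣≤∣q∣ T V) ∣V∣≤v) ⟩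
    a * u + v                             ∎
    where
    open ≤-Reasoning
    V : Subset k
    V = fromDec (λ c → toℕ c <? v)
    ∣V∣≤v : ∣ V ∣ ≤ v
    ∣V∣≤v = injection⇒∣p∣≤m {p = V} (λ c c∈V → fromℕ< (∈-fromDec⁻ (λ c → toℕ c <? v) c∈V))
      (λ _ _ eq → toℕ-injective (trans (sym (toℕ-fromℕ< _)) (trans (cong toℕ eq) (toℕ-fromℕ< _))))
    fibre-small : ∀ {c} → c ∈ V → ∣ ⊤ ∩ preimage (residue {N}) ⁅ c ⁆ ∣ ≤ suc u
    fibre-small {c} _ = ∣residue-fibre∣≤ {N} c (suc u) (λ j _ → m<n*o⇒m/o<n (begin-strict
      toℕ j       <⟨ toℕ<n j ⟩
      N           ≤⟨ N≤uk+v ⟩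
      u * k + v   ≤⟨ +-monoʳ-≤ (u * k) v≤k ⟩
      u * k + k   ≡⟨ +-comm (u * k) k ⟩
      suc u * k   ∎))
    fibre-large : ∀ {c} → c ∉ V → ∣ ⊤ ∩ preimage (residue {N}) ⁅ c ⁆ ∣ ≤ u
    fibre-large {c} c∉V = ∣residue-fibre∣≤ {N} c u (λ j residue≡c → *-cancelʳ-< k (toℕ j / k) u
      (+-cancelʳ-< (toℕ c) ((toℕ j / k) * k) (u * k) (begin-strict
        (toℕ j / k) * k + toℕ c          ≡⟨ +-comm _ (toℕ c) ⟩
        toℕ c + (toℕ j / k) * k          ≡⟨ cong (λ r → toℕ r + (toℕ j / k) * k) residue≡c ⟨
        toℕ (residue j) + (toℕ j / k) * k ≡⟨ toℕ-residue j ⟨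
        toℕ j                            <⟨ toℕ<n j ⟩
        N                                ≤⟨ N≤uk+v ⟩
        u * k + v                        ≤⟨ +-monoʳ-≤ (u * k) v≤c ⟩
        u * k + toℕ c                    ∎)))
      where
      v≤c : v ≤ toℕ c
      v≤c = ≮⇒≥ (λ c<v → c∉V (∈-fromDec⁺ (λ c → toℕ c <? v) c<v))

  many-points⇒many-residues : ∀ {N} u v → N ≤ u * k + v → v ≤ k →
    ∀ a (X : Subset N) → a * u + v < ∣ X ∣ → suc a ≤ ∣ image residue X ∣
  many-points⇒many-residues {N} u v N≤uk+v v≤k a X au+v<∣X∣ with suc a ≤? ∣ image residue X ∣
  ... | yes a<∣image∣ = a<∣image∣
  ... | no a≮∣image∣ = ⊥-elim (<⇒≱ au+v<∣X∣ (begin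
    ∣ X ∣                                         ≤⟨ p⊆q⇒∣p∣≤∣q∣ (⊆-preimage-image residue X) ⟩
    ∣ preimage (residue {N}) (image residue X) ∣  ≤⟨ ∣preimage-residue∣≤ u v N≤uk+v v≤k a (image residue X) (≮⇒≥ a≮∣image∣) ⟩
    a * u + v                                     ∎))
    where open ≤-Reasoning

subsetsOfSize : (k a : ℕ) → List (Subset k)
subsetsOfSize zero zero = [] ∷ []
subsetsOfSize zero (suc a) = []
subsetsOfSize (suc k) zero = List.map (outside ∷_) (subsetsOfSize k zero)
subsetsOfSize (suc k) (suc a) =
  List.map (inside ∷_) (subsetsOfSize k a) ++ List.map (outside ∷_) (subsetsOfSize k (suc a))

length-subsetsOfSize : ∀ k a → length (subsetsOfSize k a) ≡ k C a
length-subsetsOfSize zero zero = refl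
length-subsetsOfSize zero (suc a) = refl
length-subsetsOfSize (suc k) zero =
  trans (length-map _ (subsetsOfSize k zero)) (length-subsetsOfSize k zero)
length-subsetsOfSize (suc k) (suc a) = begin
  length (List.map (inside ∷_) (subsetsOfSize k a) ++ List.map (outside ∷_) (subsetsOfSize k (suc a)))
    ≡⟨ length-++ (List.map (inside ∷_) (subsetsOfSize k a)) ⟩
  length (List.map (inside ∷_) (subsetsOfSize k a)) + length (List.map (outside ∷_) (subsetsOfSize k (suc a)))
    ≡⟨ cong₂ _+_ (trans (length-map _ (subsetsOfSize k a)) (length-subsetsOfSize k a))
                 (trans (length-map _ (subsetsOfSize k (suc a))) (length-subsetsOfSize k (suc a))) ⟩
  k C a + k C suc a
    ≡⟨ nCk+nC[k+1]≡[n+1]C[k+1] k a ⟩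
  suc k C suc a ∎
  where open ≡-Reasoning

∈-subsetsOfSize : ∀ {k} (T : Subset k) → T ∈ₗ subsetsOfSize k ∣ T ∣
∈-subsetsOfSize [] = Any.here refl
∈-subsetsOfSize {suc k} (inside ∷ T) = ∈-++⁺ˡ (∈-map⁺ (inside ∷_) (∈-subsetsOfSize T))
∈-subsetsOfSize {suc k} (outside ∷ T) with ∣ T ∣ | ∈-subsetsOfSize T
... | zero | T∈ = ∈-map⁺ (outside ∷_) T∈
... | suc a | T∈ = ∈-++⁺ʳ (List.map (inside ∷_) (subsetsOfSize k a)) (∈-map⁺ (outside ∷_) T∈)

∈-subsetsOfSize⇒∣T∣≡a : ∀ k a {T} → T ∈ₗ subsetsOfSize k a → ∣ T ∣ ≡ a
∈-subsetsOfSize⇒∣T∣≡a zero zero (Any.here refl) = refl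
∈-subsetsOfSize⇒∣T∣≡a (suc k) zero T∈ with ∈-map⁻ (outside ∷_) T∈
... | (T , T∈′ , refl) = ∈-subsetsOfSize⇒∣T∣≡a k zero T∈′
∈-subsetsOfSize⇒∣T∣≡a (suc k) (suc a) T∈ with ∈-++⁻ (List.map (inside ∷_) (subsetsOfSize k a)) T∈
... | inj₁ T∈ˡ with ∈-map⁻ (inside ∷_) T∈ˡ
...   | (T , T∈′ , refl) = cong suc (∈-subsetsOfSize⇒∣T∣≡a k a T∈′)
∈-subsetsOfSize⇒∣T∣≡a (suc k) (suc a) T∈ | inj₂ T∈ʳ with ∈-map⁻ (outside ∷_) T∈ʳ
...   | (T , T∈′ , refl) = ∈-subsetsOfSize⇒∣T∣≡a k (suc a) T∈′

nCk≤[1+n]Ck : ∀ n k → n C k ≤ suc n C k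
nCk≤[1+n]Ck n zero = ≤-refl
nCk≤[1+n]Ck n (suc k) =
  ≤-trans (m≤n+m (n C suc k) (n C k)) (≤-reflexive (nCk+nC[k+1]≡[n+1]C[k+1] n k))

C-monoˡ-≤ : ∀ {m n} k → m ≤ n → m C k ≤ n C k
C-monoˡ-≤ {m} k m≤n with m≤n⇒∃[o]m+o≡n m≤n
... | (o , refl) = go o
  where
  go : ∀ o → m C k ≤ (m + o) C k
  go zero = ≤-reflexive (cong (_C k) (sym (+-identityʳ m)))
  go (suc o) = ≤-trans (go o) (≤-trans (nCk≤[1+n]Ck (m + o) k) (≤-reflexive (cong (_C k) (sym (+-suc m o)))))

1≤nCk : ∀ n k → k ≤ n → 1 ≤ n C k
1≤nCk n zero _ = ≤-refl
1≤nCk (suc n) (suc k) (s≤s k≤n) =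
  ≤-trans (1≤nCk n k k≤n) (≤-trans (m≤m+n (n C k) (n C suc k)) (≤-reflexive (nCk+nC[k+1]≡[n+1]C[k+1] n k)))

n≤nCk : ∀ n k → 1 ≤ k → k < n → n ≤ n C k
n≤nCk (suc n) (suc zero) _ _ = ≤-reflexive (sym (nC1≡n (suc n)))
n≤nCk (suc (suc n)) (suc (suc k)) _ (s≤s k+1<n+1) = begin
  suc (suc n)                               ≡⟨ +-comm 1 (suc n) ⟩
  suc n + 1                                 ≤⟨ +-mono-≤ (n≤nCk (suc n) (suc k) (s≤s z≤n) k+1<n+1) (1≤nCk (suc n) (suc (suc k)) k+1<n+1) ⟩
  suc n C suc k + suc n C suc (suc k)       ≡⟨ nCk+nC[k+1]≡[n+1]C[k+1] (suc n) (suc k) ⟩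
  suc (suc n) C suc (suc k)                 ∎
  where open ≤-Reasoning

-- Edges of H(n, r, q ∣ σ) and their colours

module _ {n q k : ℕ} (c : Colouring n q k) (K : VSubset n q) where

  private
    singletonIfIn : Fin n → Fin q → List (Subset k)
    singletonIfIn i j = if lookup (K i) j then ⁅ c i j ⁆ ∷ [] else []

  ∈-coloursOn⁺ : ∀ {i j} → j ∈ K i → c i j ∈ coloursOn c K
  ∈-coloursOn⁺ {i} {j} j∈ =
    ∈-⋃⁺ _ (∈-concatMap⁺ (λ i → concatMap (singletonIfIn i) (allFin q)) (lose (∈-allFin i) listed)) (x∈⁅x⁆ (c i j))
    where
    listed : ⁅ c i j ⁆ ∈ₗ concatMap (singletonIfIn i) (allFin q)
    listed = ∈-concatMap⁺ (singletonIfIn i) (lose (∈-allFin j) listed-at-j)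
      where
      listed-at-j : ⁅ c i j ⁆ ∈ₗ singletonIfIn i j
      listed-at-j rewrite []=⇒lookup j∈ = Any.here refl

  ∈-coloursOn⁻ : ∀ {col} → col ∈ coloursOn c K → ∃[ i ] ∃[ j ] j ∈ K i × c i j ≡ col
  ∈-coloursOn⁻ {col} col∈
    with ∈-⋃⁻ (concatMap (λ i → concatMap (singletonIfIn i) (allFin q)) (allFin n)) col∈
  ... | (p , p∈ , col∈p)
    with Any.satisfied (∈-concatMap⁻ (λ i → concatMap (singletonIfIn i) (allFin q)) {xs = allFin n} p∈)
  ... | (i , p∈ᵢ) with Any.satisfied (∈-concatMap⁻ (singletonIfIn i) {xs = allFin q} p∈ᵢ)
  ... | (j , p∈ᵢⱼ) = i , j , listed (lookup (K i) j) refl p∈ᵢⱼ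
    where
    listed : ∀ b → lookup (K i) j ≡ b → p ∈ₗ (if b then ⁅ c i j ⁆ ∷ [] else []) →
      j ∈ K i × c i j ≡ col
    listed true eq (Any.here refl) = lookup⇒[]= j (K i) eq , sym (x∈⁅y⁆⇒x≡y (c i j) col∈p)

  coloursOn-⊆ : ∀ {T} → (∀ {i j} → j ∈ K i → c i j ∈ T) → coloursOn c K ⊆ T
  coloursOn-⊆ {T} colours∈T col∈ =
    let (i , j , j∈ , eq) = ∈-coloursOn⁻ col∈ in subst (_∈ T) eq (colours∈T j∈)

  image⊆coloursOn : ∀ i → image (c i) (K i) ⊆ coloursOn c K
  image⊆coloursOn i col∈ =
    let (j , j∈ , eq) = ∈-image⁻ (c i) col∈ in subst (_∈ coloursOn c K) eq (∈-coloursOn⁺ j∈)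

length-filter-tabulate : ∀ {A : Set} {P : A → Set} (P? : ∀ x → Dec (P x)) m (g : Fin m → A) →
  length (filter P? (List.tabulate g)) ≡ ∣ fromDec (λ i → P? (g i)) ∣
length-filter-tabulate P? zero g = refl
length-filter-tabulate P? (suc m) g with does (P? (g zero))
... | true = cong suc (length-filter-tabulate P? m (λ i → g (suc i)))
... | false = length-filter-tabulate P? m (λ i → g (suc i))

filter-map : ∀ {A B : Set} {P : B → Set} (P? : ∀ x → Dec (P x)) (f : A → B) xs →
  filter P? (List.map f xs) ≡ List.map f (filter (λ x → P? (f x)) xs)
filter-map P? f [] = refl
filter-map P? f (x ∷ xs) with does (P? (f x))
... | true = cong (f x ∷_) (filter-map P? f xs)
... | false = filter-map P? f xs

sum-filter-nonzero : (xs : List ℕ) → sum (filter (λ m → ¬? (m ≟ℕ 0)) xs) ≡ sum xs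
sum-filter-nonzero [] = refl
sum-filter-nonzero (zero ∷ xs) = sum-filter-nonzero xs
sum-filter-nonzero (suc x ∷ xs) = cong (suc x +_) (sum-filter-nonzero xs)

module _ {n q : ℕ} (K : VSubset n q) where

  support : Subset n
  support = fromDec (λ i → ¬? (∣ K i ∣ ≟ℕ 0))

  ∈-support⁻ : ∀ {i} → i ∈ support → Nonempty (K i)
  ∈-support⁻ {i} i∈ = 1≤∣p∣⇒nonempty (K i) (n≢0⇒n>0 (∈-fromDec⁻ (λ i → ¬? (∣ K i ∣ ≟ℕ 0)) i∈))

  ∈-support⁺ : ∀ {i j} → j ∈ K i → i ∈ support
  ∈-support⁺ {i} j∈ = ∈-fromDec⁺ (λ i → ¬? (∣ K i ∣ ≟ℕ 0)) (>⇒≢ (x∈p⇒1≤∣p∣ j∈))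

  length-nonzeroSizes : length (nonzeroSizes K) ≡ ∣ support ∣
  length-nonzeroSizes = trans (cong (λ xs → length (filter (λ m → ¬? (m ≟ℕ 0)) xs)) (map-tabulate (λ i → i) (λ i → ∣ K i ∣)))
    (length-filter-tabulate (λ m → ¬? (m ≟ℕ 0)) n (λ i → ∣ K i ∣))

  edge⇒∣support∣≡∣σ∣ : ∀ {r σ} → IsEdge n r q σ K → ∣ support ∣ ≡ length σ
  edge⇒∣support∣≡∣σ∣ (_ , sizes↭σ) = trans (sym length-nonzeroSizes) (↭-length sizes↭σ)

  edge⇒part-size : ∀ {r σ x} → IsEdge n r q σ K → x ∈ₗ σ → ∃[ i ] ∣ K i ∣ ≡ x
  edge⇒part-size (_ , sizes↭σ) x∈σ
    with ∈-map⁻ (λ i → ∣ K i ∣) {xs = allFin n}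
           (proj₁ (∈-filter⁻ (λ m → ¬? (m ≟ℕ 0)) (∈-resp-↭ (↭-sym sizes↭σ) x∈σ)))
  ... | (i , _ , x≡) = i , sym x≡

assemble : ∀ {n q} → List (Fin n × Subset q) → VSubset n q
assemble [] i = ⊥
assemble ((i′ , A) ∷ ps) i = if does (i ≟ᶠ i′) then A else assemble ps i

classes : ∀ {n q} → List (Fin n × Subset q) → List (Fin n)
classes = List.map proj₁

sizes : ∀ {n q} → List (Fin n × Subset q) → List ℕ
sizes = List.map (λ p → ∣ proj₂ p ∣)

assemble-∈ : ∀ {n q} (ps : List (Fin n × Subset q)) → Unique (classes ps) →
  ∀ {i A} → (i , A) ∈ₗ ps → assemble ps i ≡ A
assemble-∈ ((i′ , A′) ∷ ps) _ {i} (Any.here refl) with i ≟ᶠ i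
... | yes _ = refl
... | no i≢i = ⊥-elim (i≢i refl)
assemble-∈ ((i′ , A′) ∷ ps) (i′∉ ∷ unique) {i} (Any.there i∈) with i ≟ᶠ i′
... | yes refl = ⊥-elim (All.lookup i′∉ (∈-map⁺ proj₁ i∈) refl)
... | no _ = assemble-∈ ps unique i∈

assemble-∉ : ∀ {n q} (ps : List (Fin n × Subset q)) {i} → ¬ (i ∈ₗ classes ps) → assemble ps i ≡ ⊥
assemble-∉ [] _ = refl
assemble-∉ ((i′ , A′) ∷ ps) {i} i∉ with i ≟ᶠ i′
... | yes refl = ⊥-elim (i∉ (Any.here refl))
... | no _ = assemble-∉ ps (λ i∈ → i∉ (Any.there i∈))

assemble-cases : ∀ {n q} (ps : List (Fin n × Subset q)) i →
  assemble ps i ≡ ⊥ ⊎ ∃[ A ] (i , A) ∈ₗ ps × assemble ps i ≡ A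
assemble-cases [] i = inj₁ refl
assemble-cases ((i′ , A′) ∷ ps) i with i ≟ᶠ i′
... | yes refl = inj₂ (A′ , Any.here refl , refl)
... | no _ with assemble-cases ps i
...   | inj₁ eq = inj₁ eq
...   | inj₂ (A , i,A∈ , eq) = inj₂ (A , Any.there i,A∈ , eq)

module _ {n q : ℕ} (ps : List (Fin n × Subset q)) (unique : Unique (classes ps))
         (nonempty : All (λ p → 1 ≤ ∣ proj₂ p ∣) ps) where

  private
    nonzero? : ∀ i → Dec (¬ (∣ assemble ps i ∣ ≡ 0))
    nonzero? i = ¬? (∣ assemble ps i ∣ ≟ℕ 0)

    occupied⇔listed : ∀ {i} → i ∈ₗ filter nonzero? (allFin n) → i ∈ₗ classes ps
    occupied⇔listed {i} i∈ with Any.any? (i ≟ᶠ_) (classes ps)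
    ... | yes i∈ps = i∈ps
    ... | no i∉ps = ⊥-elim (proj₂ (∈-filter⁻ nonzero? {xs = allFin n} i∈)
                      (trans (cong ∣_∣ (assemble-∉ ps i∉ps)) (∣⊥∣≡0 q)))

    listed⇒occupied : ∀ {i} → i ∈ₗ classes ps → i ∈ₗ filter nonzero? (allFin n)
    listed⇒occupied i∈ with ∈-map⁻ proj₁ i∈
    ... | ((i , A) , i,A∈ , refl) = ∈-filter⁺ nonzero? (∈-allFin i) (>⇒≢ (begin-strict
      0                      <⟨ All.lookup nonempty i,A∈ ⟩
      ∣ A ∣                  ≡⟨ cong ∣_∣ (assemble-∈ ps unique i,A∈) ⟨
      ∣ assemble ps i ∣      ∎))
      where open ≤-Reasoning

  nonzeroSizes-assemble : nonzeroSizes (assemble ps) ↭ sizes ps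
  nonzeroSizes-assemble = subst (_↭ sizes ps) (sym (filter-map (λ m → ¬? (m ≟ℕ 0)) _ (allFin n))) (begin
    List.map (λ i → ∣ assemble ps i ∣) (filter nonzero? (allFin n))
      ↭⟨ map⁺ _ occupied↭classes ⟩
    List.map (λ i → ∣ assemble ps i ∣) (classes ps)
      ≡⟨ trans (sym (map-∘ ps)) (map-cong-local (All.tabulate (λ i,A∈ → cong ∣_∣ (assemble-∈ ps unique i,A∈)))) ⟩
    sizes ps ∎)
    where
    open PermutationReasoning
    occupied↭classes : filter nonzero? (allFin n) ↭ classes ps
    occupied↭classes = ∼bag⇒↭ (unique∧set⇒bag (Unique.filter⁺ nonzero? (Unique.allFin⁺ n)) unique
                                                (mk⇔ occupied⇔listed listed⇒occupied))

  assemble-isEdge : ∀ {r σ} → sizes ps ↭ σ → sum σ ≡ r → IsEdge n r q σ (assemble ps)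
  assemble-isEdge {r} {σ} sizes↭σ sum≡r =
    trans (sym (sum-filter-nonzero (classSizes (assemble ps))))
          (trans (sum-↭ (↭-trans nonzeroSizes-assemble sizes↭σ)) sum≡r) ,
    ↭-trans nonzeroSizes-assemble sizes↭σ

module _ {n q k : ℕ} (c : Colouring n q k) where

  coloursOf : List (Fin n × Subset q) → Subset k
  coloursOf ps = ⋃ (List.map (λ p → image (c (proj₁ p)) (proj₂ p)) ps)

  image⊆coloursOf : ∀ ps {i A} → (i , A) ∈ₗ ps → image (c i) A ⊆ coloursOf ps
  image⊆coloursOf ps i,A∈ col∈ = ∈-⋃⁺ _ (∈-map⁺ (λ p → image (c (proj₁ p)) (proj₂ p)) i,A∈) col∈

  coloursOf-⊆ : ∀ ps {T} → (∀ {i A} → (i , A) ∈ₗ ps → image (c i) A ⊆ T) → coloursOf ps ⊆ T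
  coloursOf-⊆ ps images⊆T col∈ with ∈-⋃⁻ (List.map (λ p → image (c (proj₁ p)) (proj₂ p)) ps) col∈
  ... | (P , P∈ , col∈P) with ∈-map⁻ (λ p → image (c (proj₁ p)) (proj₂ p)) P∈
  ... | ((i , A) , i,A∈ , refl) = images⊆T i,A∈ col∈P

  coloursOn-assemble⊆coloursOf : ∀ ps → coloursOn c (assemble ps) ⊆ coloursOf ps
  coloursOn-assemble⊆coloursOf ps = coloursOn-⊆ c (assemble ps) colour∈
    where
    colour∈ : ∀ {i j} → j ∈ assemble ps i → c i j ∈ coloursOf ps
    colour∈ {i} {j} j∈ with assemble-cases ps i
    ... | inj₁ eq = ⊥-elim (∉⊥ (subst (j ∈_) eq j∈))
    ... | inj₂ (A , i,A∈ , eq) = image⊆coloursOf ps i,A∈ (∈-image⁺ (c i) (subst (j ∈_) eq j∈))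

  coloursOf⊆coloursOn-assemble : ∀ ps → Unique (classes ps) → coloursOf ps ⊆ coloursOn c (assemble ps)
  coloursOf⊆coloursOn-assemble ps unique = coloursOf-⊆ ps λ {i} i,A∈ col∈ →
    image⊆coloursOn c (assemble ps) i (subst (λ A → _ ∈ image (c i) A) (sym (assemble-∈ ps unique i,A∈)) col∈)

elements : ∀ {n} → Subset n → List (Fin n)
elements S = List.map (enumerate S) (allFin ∣ S ∣)

elements-unique : ∀ {n} (S : Subset n) → Unique (elements S)
elements-unique S = Unique.map⁺ (enumerate-injective S) (Unique.allFin⁺ _)

length-elements : ∀ {n} (S : Subset n) → length (elements S) ≡ ∣ S ∣
length-elements S = trans (length-map (enumerate S) (allFin ∣ S ∣)) (length-tabulate (λ x → x))

∈-elements⁻ : ∀ {n} (S : Subset n) {i} → i ∈ₗ elements S → i ∈ S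
∈-elements⁻ S i∈ with ∈-map⁻ (enumerate S) i∈
... | (u , _ , refl) = enumerate-∈ S u

allot : ∀ {n q} → (Fin n → ℕ → Subset q) → List (Fin n) → List ℕ → List (Fin n × Subset q)
allot f (i ∷ is) (p ∷ ps) = (i , f i p) ∷ allot f is ps
allot f _ _ = []

classes-allot : ∀ {n q} (f : Fin n → ℕ → Subset q) is ps → length is ≡ length ps →
  classes (allot f is ps) ≡ is
classes-allot f [] [] _ = refl
classes-allot f (i ∷ is) (p ∷ ps) eq = cong (i ∷_) (classes-allot f is ps (suc-injective eq))

sizes-allot : ∀ {n q} (f : Fin n → ℕ → Subset q) is ps → length is ≡ length ps →
  (∀ {i p} → i ∈ₗ is → p ∈ₗ ps → ∣ f i p ∣ ≡ p) → sizes (allot f is ps) ≡ ps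
sizes-allot f [] [] _ _ = refl
sizes-allot f (i ∷ is) (p ∷ ps) eq sized = cong₂ _∷_ (sized (Any.here refl) (Any.here refl))
  (sizes-allot f is ps (suc-injective eq) (λ i∈ p∈ → sized (Any.there i∈) (Any.there p∈)))

∈-allot⁻ : ∀ {n q} (f : Fin n → ℕ → Subset q) is ps {i A} → (i , A) ∈ₗ allot f is ps →
  i ∈ₗ is × ∃[ p ] p ∈ₗ ps × A ≡ f i p
∈-allot⁻ f (i ∷ is) (p ∷ ps) (Any.here refl) = Any.here refl , p , Any.here refl , refl
∈-allot⁻ f (i ∷ is) (p ∷ ps) (Any.there i,A∈) =
  let (i∈ , p′ , p′∈ , eq) = ∈-allot⁻ f is ps i,A∈ in Any.there i∈ , p′ , Any.there p′∈ , eq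

split-out : ∀ {xs : List ℕ} {x} → x ∈ₗ xs → 2 ≤ length xs → ∃[ y ] ∃[ ys ] xs ↭ x ∷ y ∷ ys
split-out {x = x} x∈ 2≤∣xs∣ with ∈-∃++ x∈
... | (ys , zs , refl) with ys ++ zs in eq
...   | [] = ⊥-elim (1+n≰n (≤-pred (≤-trans 2≤∣xs∣ (≤-reflexive
           (trans (↭-length (shift x ys zs)) (cong (λ l → suc (length l)) eq))))))
...   | y ∷ ws = y , ws , subst (λ l → ys ++ x ∷ zs ↭ x ∷ l) eq (shift x ys zs)

1≤n⇒m≤n*m : ∀ m {n} → 1 ≤ n → m ≤ n * m
1≤n⇒m≤n*m m 1≤n = ≤-trans (≤-reflexive (sym (*-identityˡ m))) (*-monoˡ-≤ m 1≤n)

-- In the notation of the paper a = α − 1, b = β − α and m = ⌊(Δ − 1)/(α − 1)⌋.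
module Constants (a b Δ : ℕ) .{{_ : NonZero a}} where

  D m t q β : ℕ
  D = Δ ∸ 1
  m = D / a
  t = D % a
  q = (b + 1) * m + D
  β = suc a + b

module ConstantsProperties (a b Δ : ℕ) .{{_ : NonZero a}} (a<Δ : a < Δ) where

  open Constants a b Δ

  Δ≡1+D : Δ ≡ suc D
  Δ≡1+D = sym (trans (+-comm 1 D) (m∸n+n≡m (≤-trans (s≤s z≤n) a<Δ)))

  1≤m : 1 ≤ m
  1≤m = ≤-trans (≤-reflexive (sym (n/n≡1 a))) (/-monoˡ-≤ a (≤-pred (subst (a <_) Δ≡1+D a<Δ)))

  D≡t+m*a : D ≡ t + m * a
  D≡t+m*a = m≡m%n+[m/n]*n D a

  D<a*[1+m] : D < a * suc m
  D<a*[1+m] = begin-strict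
    D            ≡⟨ D≡t+m*a ⟩
    t + m * a    <⟨ +-monoˡ-< (m * a) (m%n<n D a) ⟩
    a + m * a    ≡⟨ *-comm (suc m) a ⟩
    a * suc m    ∎
    where open ≤-Reasoning

  D+b*m<q : D + b * m < q
  D+b*m<q = begin-strict
    D + b * m        <⟨ m<m+n (D + b * m) 1≤m ⟩
    D + b * m + m    ≡⟨ rearrange b m D ⟩
    q                ∎
    where
    open ≤-Reasoning
    rearrange : ∀ b m D → D + b * m + m ≡ (b + 1) * m + D
    rearrange = solve-∀

  Δ≤q : Δ ≤ q
  Δ≤q = subst (_≤ q) (sym Δ≡1+D) (+-monoˡ-≤ D (≤-trans 1≤m (1≤n⇒m≤n*m m (m≤n+m 1 b))))

  q≡m*β+t : q ≡ m * β + t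
  q≡m*β+t = trans (cong ((b + 1) * m +_) D≡t+m*a) (rearrange b m a t)
    where
    rearrange : ∀ b m a t → (b + 1) * m + (t + m * a) ≡ m * (suc a + b) + t
    rearrange = solve-∀

  a*m+t≡D : a * m + t ≡ D
  a*m+t≡D = trans (+-comm (a * m) t) (trans (cong (t +_) (*-comm a m)) (sym D≡t+m*a))

  t≤β : t ≤ β
  t≤β = ≤-trans (<⇒≤ (m%n<n D a)) (≤-trans (n≤1+n a) (m≤m+n (suc a) b))

  β≤q : β ≤ q
  β≤q = begin
    β             ≤⟨ 1≤n⇒m≤n*m β 1≤m ⟩
    m * β         ≤⟨ m≤m+n (m * β) t ⟩
    m * β + t     ≡⟨ q≡m*β+t ⟨
    q             ∎
    where open ≤-Reasoning

module _ {n r : ℕ} {σ : List ℕ} (a b Δ : ℕ) .{{_ : NonZero a}} where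

  open Constants a b Δ

  β-colouring : a < Δ → 1 ≤ n → Δ ∈ₗ σ → HasColouring n r q σ (suc a) β β
  β-colouring a<Δ 1≤n Δ∈σ = c , surjective , bounds
    where
    open ConstantsProperties a b Δ a<Δ
    c : Colouring n q β
    c i j = residue β j
    surjective : ∀ col → ∃[ i ] ∃[ j ] c i j ≡ col
    surjective col = fromℕ< 1≤n , residue-surjective β β≤q col
    bounds : ∀ K → IsEdge n r q σ K → suc a ≤ numColours c K × numColours c K ≤ β
    bounds K K-edge with edge⇒part-size K K-edge Δ∈σ
    ... | (i , ∣Ki∣≡Δ) = ≤-trans many-residues (p⊆q⇒∣p∣≤∣q∣ (image⊆coloursOn c K i)) , ∣p∣≤n (coloursOn c K)
      where
      many-residues : suc a ≤ ∣ image (residue β) (K i) ∣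
      many-residues = many-points⇒many-residues β m t (≤-reflexive q≡m*β+t) t≤β a (K i)
        (subst₂ _<_ (sym a*m+t≡D) (trans (sym Δ≡1+D) (sym ∣Ki∣≡Δ)) ≤-refl)

⌈x/m⌉≤k⇒x≤k*m : ∀ x m k → 1 ≤ m → ⌈ x / m ⌉ ≤ k → x ≤ k * m
⌈x/m⌉≤k⇒x≤k*m x (suc m) k _ ⌈x/m⌉≤k = ≤-pred (+-cancelʳ-≤ m (suc x) (suc (k * suc m)) (begin-strict
  x + m                                          ≡⟨ m≡m%n+[m/n]*n (x + m) (suc m) ⟩
  (x + m) % suc m + ((x + m) / suc m) * suc m    <⟨ +-mono-<-≤ (m%n<n (x + m) (suc m)) (*-monoˡ-≤ (suc m) ⌈x/m⌉≤k) ⟩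
  suc m + k * suc m                              ≡⟨ rearrange m k ⟩
  suc (k * suc m) + m                            ∎))
  where
  open ≤-Reasoning
  rearrange : ∀ m k → suc m + k * suc m ≡ suc (k * suc m) + m
  rearrange = solve-∀

x≤k*m⇒⌈x/m⌉≤k : ∀ x m k → 1 ≤ m → x ≤ k * m → ⌈ x / m ⌉ ≤ k
x≤k*m⇒⌈x/m⌉≤k x (suc m) k _ x≤k*m = ≤-pred (m<n*o⇒m/o<n (begin-strict
  x + m               ≤⟨ +-monoˡ-≤ m x≤k*m ⟩
  k * suc m + m       <⟨ n<1+n _ ⟩
  suc (k * suc m + m) ≡⟨ rearrange m k ⟩
  suc k * suc m       ∎))
  where
  open ≤-Reasoning
  rearrange : ∀ m k → suc (k * suc m + m) ≡ suc k * suc m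
  rearrange = solve-∀

module _ {n r q : ℕ} {σ : List ℕ} (a β : ℕ) .{{_ : NonZero a}} where

  private
    s u v : ℕ
    s = length σ
    u = (s ∸ 1) / a
    v = s ∸ 1 ∸ a * u

    1≤u : a < s → 1 ≤ u
    1≤u a<s = ≤-trans (≤-reflexive (sym (n/n≡1 a))) (/-monoˡ-≤ a (∸-monoˡ-≤ 1 a<s))

  class-colouring : 1 ≤ q → a < length σ → length σ ≤ β → length σ ≤ n →
    ∀ k → ⌈ n ∸ v / u ⌉ ≤ k → k ≤ n → HasColouring n r q σ (suc a) β k
  class-colouring 1≤q a<s s≤β s≤n k ⌈n∸v/u⌉≤k k≤n = c , surjective , bounds
    where
    a*u+v≡s∸1 : a * u + v ≡ s ∸ 1
    a*u+v≡s∸1 = m+[n∸m]≡n (≤-trans (≤-reflexive (*-comm a u)) (m/n*n≤m (s ∸ 1) a))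
    v<a : v < a
    v<a = subst (_< a) (trans (m%n≡m∸m/n*n (s ∸ 1) a) (cong (s ∸ 1 ∸_) (*-comm u a))) (m%n<n (s ∸ 1) a)
    s∸1<s : s ∸ 1 < s
    s∸1<s = ∸-monoʳ-< {o = 0} (s≤s z≤n) (≤-trans (s≤s z≤n) a<s)
    n≤u*k+v : n ≤ u * k + v
    n≤u*k+v = begin
      n                ≤⟨ m≤n+m∸n n v ⟩
      v + (n ∸ v)      ≡⟨ +-comm v (n ∸ v) ⟩
      n ∸ v + v        ≤⟨ +-monoˡ-≤ v (⌈x/m⌉≤k⇒x≤k*m (n ∸ v) u k (1≤u a<s) ⌈n∸v/u⌉≤k) ⟩
      k * u + v        ≡⟨ cong (_+ v) (*-comm k u) ⟩
      u * k + v        ∎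
      where open ≤-Reasoning
    a<k : a < k
    a<k = ≰⇒> λ k≤a → <⇒≱ s∸1<s (begin
      s                ≤⟨ s≤n ⟩
      n                ≤⟨ n≤u*k+v ⟩
      u * k + v        ≤⟨ +-monoˡ-≤ v (*-monoʳ-≤ u k≤a) ⟩
      u * a + v        ≡⟨ cong (_+ v) (*-comm u a) ⟩
      a * u + v        ≡⟨ a*u+v≡s∸1 ⟩
      s ∸ 1            ∎)
      where open ≤-Reasoning
    instance
      k≢0 : NonZero k
      k≢0 = >-nonZero (≤-trans (s≤s z≤n) a<k)
    c : Colouring n q k
    c i j = residue k i
    surjective : ∀ col → ∃[ i ] ∃[ j ] c i j ≡ col
    surjective col = let (i , eq) = residue-surjective k k≤n col in i , fromℕ< 1≤q , eq
    bounds : ∀ K → IsEdge n r q σ K → suc a ≤ numColours c K × numColours c K ≤ β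
    bounds K K-edge = lower , upper
      where
      ∣support∣≡s : ∣ support K ∣ ≡ s
      ∣support∣≡s = edge⇒∣support∣≡∣σ∣ K K-edge
      image⊆colours : image (residue k) (support K) ⊆ coloursOn c K
      image⊆colours col∈ =
        let (i , i∈ , eq) = ∈-image⁻ (residue k) col∈
        in subst (_∈ coloursOn c K) eq (∈-coloursOn⁺ c K (proj₂ (∈-support⁻ K i∈)))
      colours⊆image : coloursOn c K ⊆ image (residue k) (support K)
      colours⊆image = coloursOn-⊆ c K (λ j∈ → ∈-image⁺ (residue k) (∈-support⁺ K j∈))
      lower : suc a ≤ numColours c K
      lower = ≤-trans (many-points⇒many-residues k u v n≤u*k+v (<⇒≤ (<-trans v<a a<k)) a (support K)
                        (subst₂ _<_ (sym a*u+v≡s∸1) (sym ∣support∣≡s) s∸1<s))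
                      (p⊆q⇒∣p∣≤∣q∣ image⊆colours)
      upper : numColours c K ≤ β
      upper = ≤-trans (p⊆q⇒∣p∣≤∣q∣ colours⊆image)
                (≤-trans (∣image∣≤∣X∣ (residue k) (support K)) (≤-trans (≤-reflexive ∣support∣≡s) s≤β))

  n-colouring : 1 ≤ q → a < length σ → length σ ≤ β → length σ ≤ n → HasColouring n r q σ (suc a) β n
  n-colouring 1≤q a<s s≤β s≤n = class-colouring 1≤q a<s s≤β s≤n n (x≤k*m⇒⌈x/m⌉≤k (n ∸ v) u n (1≤u a<s) (begin
    n ∸ v    ≤⟨ m∸n≤m n v ⟩
    n        ≤⟨ 1≤n⇒m≤n*m n (1≤u a<s) ⟩
    u * n    ≡⟨ *-comm u n ⟩
    n * u    ∎)) ≤-refl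
    where open ≤-Reasoning

-- Collecting new colours class by class

module _ {q k : ℕ} (h : Fin q → Fin k) (j₀ : Fin q) where

  representative : Fin k → Fin q
  representative y with any? (λ j → h j ≟ᶠ y)
  ... | yes (j , _) = j
  ... | no _ = j₀

  h-representative : ∀ {y} → y ∈ image h ⊤ → h (representative y) ≡ y
  h-representative {y} y∈ with any? (λ j → h j ≟ᶠ y)
  ... | yes (j , hj≡y) = hj≡y
  ... | no none = ⊥-elim (none (let (j , _ , hj≡y) = ∈-image⁻ h y∈ in j , hj≡y))

  cover : ∀ (W : Subset k) p → W ⊆ image h ⊤ → ∣ W ∣ ≤ p → p ≤ q → ∃[ A ] ∣ A ∣ ≡ p × W ⊆ image h A
  cover W p W⊆image ∣W∣≤p p≤q =
    let (A , R⊆A , _ , ∣A∣≡p) = subset-between R ⊤ p (λ _ → ∈⊤) (≤-trans (∣image∣≤∣X∣ representative W) ∣W∣≤p)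
                                                (≤-trans p≤q (≤-reflexive (sym (∣⊤∣≡n q))))
    in A , ∣A∣≡p , λ y∈W → subst (_∈ image h A) (h-representative (W⊆image y∈W))
                               (∈-image⁺ h (R⊆A (∈-image⁺ representative y∈W)))
    where
    R = image representative W

  new⊆image⇒all⊆image : ∀ U {A} → image h ⊤ ─ U ⊆ image h A → U ∪ image h ⊤ ⊆ U ∪ image h A
  new⊆image⇒all⊆image U {A} new⊆ = ∪-⊆ (p⊆p∪q _) caught
    where
    caught : image h ⊤ ⊆ U ∪ image h A
    caught {y} y∈ with y ∈? U
    ... | yes y∈U = p⊆p∪q _ y∈U
    ... | no y∉U = q⊆p∪q U _ (new⊆ (─⁺ y∈ y∉U))

  opaque
    add-class : ∀ (U : Subset k) p → p ≤ q → ∃[ A ] ∣ A ∣ ≡ p ×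
      (∣ U ∣ + p ≤ ∣ U ∪ image h A ∣ ⊎ ∣ U ∪ image h ⊤ ∣ ≤ ∣ U ∪ image h A ∣)
    add-class U p p≤q with ∣ image h ⊤ ─ U ∣ ≤? p
    ... | yes ∣new∣≤p =
      let (A , ∣A∣≡p , new⊆) = cover (image h ⊤ ─ U) p ─⁻ˡ ∣new∣≤p p≤q
      in A , ∣A∣≡p , inj₂ (p⊆q⇒∣p∣≤∣q∣ (new⊆image⇒all⊆image U new⊆))
    ... | no ∣new∣≰p =
      let (W , W⊆new , ∣W∣≡p) = subset-of-size (image h ⊤ ─ U) p (<⇒≤ (≰⇒> ∣new∣≰p))
          (A , ∣A∣≡p , W⊆) = cover W p (λ y∈ → ─⁻ˡ (W⊆new y∈)) (≤-reflexive ∣W∣≡p) p≤q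
      in A , ∣A∣≡p , inj₁ (begin
        ∣ U ∣ + p            ≡⟨ cong (∣ U ∣ +_) ∣W∣≡p ⟨
        ∣ U ∣ + ∣ W ∣        ≡⟨ disjoint⇒∣p∪q∣≡∣p∣+∣q∣ U W (λ y∈U y∈W → ─⁻ʳ (W⊆new y∈W) y∈U) ⟨
        ∣ U ∪ W ∣            ≤⟨ p⊆q⇒∣p∣≤∣q∣ (∪-⊆ (p⊆p∪q _) (λ y∈ → q⊆p∪q U _ (W⊆ y∈))) ⟩
        ∣ U ∪ image h A ∣    ∎)
      where open ≤-Reasoning

collect-count : ∀ β {u p s i u′ v} → β ≤ i → u + p ≤ u′ ⊎ i ≤ u′ → β ≤ v ⊎ u′ + s ≤ v →
  β ≤ v ⊎ u + (p + s) ≤ v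
collect-count β _ _ (inj₁ β≤v) = inj₁ β≤v
collect-count β {u} {p} {s} _ (inj₁ u+p≤u′) (inj₂ u′+s≤v) =
  inj₂ (≤-trans (≤-reflexive (sym (+-assoc u p s))) (≤-trans (+-monoˡ-≤ s u+p≤u′) u′+s≤v))
collect-count β {s = s} {u′ = u′} β≤i (inj₂ i≤u′) (inj₂ u′+s≤v) =
  inj₁ (≤-trans β≤i (≤-trans i≤u′ (≤-trans (m≤m+n u′ s) u′+s≤v)))

module _ {n q k : ℕ} (c : Colouring n q k) (j₀ : Fin q) (β : ℕ) where

  Collected : List (Fin n) → List ℕ → Subset k → Set
  Collected is ps U = ∃[ L ] classes L ≡ is × sizes L ≡ ps ×
    (β ≤ ∣ U ∪ coloursOf c L ∣ ⊎ ∣ U ∣ + sum ps ≤ ∣ U ∪ coloursOf c L ∣)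

  opaque
    collect : ∀ is ps → length is ≡ length ps → (∀ {i} → i ∈ₗ is → β ≤ ∣ image (c i) ⊤ ∣) →
      All (_≤ q) ps → ∀ U → Collected is ps U
    collect [] [] _ _ _ U = [] , refl , refl , inj₂ (≤-trans (≤-reflexive (+-identityʳ _)) (∣p∣≤∣p∪q∣ U ⊥))
    collect (i ∷ is) (p ∷ ps) length≡ many (p≤q All.∷ ps≤q) U
      with add-class (c i) j₀ U p p≤q
    ... | (A , ∣A∣≡p , added)
      with collect is ps (suc-injective length≡) (λ i∈ → many (Any.there i∈)) ps≤q (U ∪ image (c i) A)
    ... | (L , classes≡ , sizes≡ , collected) =
      (i , A) ∷ L , cong (i ∷_) classes≡ , cong₂ _∷_ ∣A∣≡p sizes≡ ,
      subst (λ V → β ≤ ∣ V ∣ ⊎ ∣ U ∣ + (p + sum ps) ≤ ∣ V ∣) (∪-assoc U (image (c i) A) (coloursOf c L))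
        (collect-count β {u = ∣ U ∣} {p = p} (≤-trans (many (Any.here refl)) (∣q∣≤∣p∪q∣ U (image (c i) ⊤))) added collected)

-- Colourings with fewer than β or exactly β + 1 colours

-- e, f and F count the colours of an edge under construction after its first class, its middle
-- classes and its last class; e∪I and f∪I add all colours seen by the last class.
colour-count-exceeds-β : ∀ {β δ p s r e e∪I f f∪I F} → 1 ≤ e → β < e∪I → e∪I ≤ f∪I → 1 ≤ p →
  δ + β ≤ r → δ + (p + s) ≡ r → β ≤ f ⊎ e + s ≤ f → f + p ≤ F ⊎ f∪I ≤ F → β < F
colour-count-exceeds-β _ β<e∪I e∪I≤f∪I _ _ _ _ (inj₂ f∪I≤F) = <-≤-trans β<e∪I (≤-trans e∪I≤f∪I f∪I≤F)
colour-count-exceeds-β {β} _ _ _ 1≤p _ _ (inj₁ β≤f) (inj₁ f+p≤F) =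
  <-≤-trans (m<m+n β 1≤p) (≤-trans (+-monoˡ-≤ _ β≤f) f+p≤F)
colour-count-exceeds-β {β} {δ} {p} {s} {e = e} 1≤e _ _ _ δ+β≤r δ+p+s≡r (inj₂ e+s≤f) (inj₁ f+p≤F) = begin-strict
  β              ≤⟨ +-cancelˡ-≤ δ β (p + s) (≤-trans δ+β≤r (≤-reflexive (sym δ+p+s≡r))) ⟩
  p + s          ≡⟨ +-comm p s ⟩
  s + p          <⟨ +-monoˡ-≤ p (+-monoˡ-≤ s 1≤e) ⟩
  e + s + p      ≤⟨ +-monoˡ-≤ p e+s≤f ⟩
  _              ≤⟨ f+p≤F ⟩
  _              ∎
  where open ≤-Reasoning

module _ (a b Δ : ℕ) .{{_ : NonZero a}} (a<Δ : a < Δ) where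

  open Constants a b Δ
  open ConstantsProperties a b Δ a<Δ

  ∣preimage⊤∣≡q : ∀ {k} (h : Fin q → Fin k) → ∣ preimage h ⊤ ∣ ≡ q
  ∣preimage⊤∣≡q h = trans (⊆⊇⇒∣p∣≡∣q∣ (preimage h ⊤) ⊤ (λ _ → ∈⊤) (λ _ → ∈-preimage⁺ h ⊤ ∈⊤)) (∣⊤∣≡n q)

  j₀ : Fin q
  j₀ = fromℕ< (≤-trans (s≤s z≤n) (≤-trans a<Δ Δ≤q))

  module _ {n r : ℕ} {σ : List ℕ} (σ-pos : All (1 ≤_) σ) (sum-σ : sum σ ≡ r) (σ≤Δ : All (_≤ Δ) σ)
           {k : ℕ} (c : Colouring n q k) where

    part-positive : ∀ {x} → x ∈ₗ σ → 1 ≤ x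
    part-positive = All.lookup σ-pos

    part≤q : ∀ {x} → x ∈ₗ σ → x ≤ q
    part≤q x∈ = ≤-trans (All.lookup σ≤Δ x∈) Δ≤q

    richClasses : Subset k → Subset n
    richClasses T = fromDec (λ i → Δ ≤? ∣ preimage (c i) T ∣)

    edge-coloured-within : ∀ T (S : Subset n) → ∣ S ∣ ≡ length σ → S ⊆ richClasses T →
      ∃[ K ] IsEdge n r q σ K × coloursOn c K ⊆ T
    edge-coloured-within T S ∣S∣≡s S⊆rich =
      assemble ps , assemble-isEdge ps unique nonempty (↭-reflexive sizes≡σ) sum-σ ,
      λ col∈ → coloursOf-⊆ c ps images⊆T (coloursOn-assemble⊆coloursOf c ps col∈)
      where
      part : Fin n → ℕ → Subset q
      part i p = choose (preimage (c i) T) p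
      ps = allot part (elements S) σ
      length≡ : length (elements S) ≡ length σ
      length≡ = trans (length-elements S) ∣S∣≡s
      fits : ∀ {i p} → i ∈ₗ elements S → p ∈ₗ σ → p ≤ ∣ preimage (c i) T ∣
      fits i∈ p∈ = ≤-trans (All.lookup σ≤Δ p∈)
        (∈-fromDec⁻ (λ i → Δ ≤? ∣ preimage (c i) T ∣) (S⊆rich (∈-elements⁻ S i∈)))
      unique : Unique (classes ps)
      unique = subst Unique (sym (classes-allot part (elements S) σ length≡)) (elements-unique S)
      sizes≡σ : sizes ps ≡ σ
      sizes≡σ = sizes-allot part (elements S) σ length≡ (λ i∈ p∈ → ∣choose∣≡k _ _ (fits i∈ p∈))
      nonempty : All (λ p → 1 ≤ ∣ proj₂ p ∣) ps
      nonempty = All.tabulate λ i,A∈ → let (i∈ , p , p∈ , A≡) = ∈-allot⁻ part (elements S) σ i,A∈ in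
        subst (λ A → 1 ≤ ∣ A ∣) (sym A≡) (subst (1 ≤_) (sym (∣choose∣≡k _ _ (fits i∈ p∈))) (All.lookup σ-pos p∈))
      images⊆T : ∀ {i A} → (i , A) ∈ₗ ps → image (c i) A ⊆ T
      images⊆T {i} i,A∈ col∈ with ∈-allot⁻ part (elements S) σ i,A∈ | ∈-image⁻ (c i) col∈
      ... | (i∈ , p , p∈ , refl) | (j , j∈ , refl) =
        ∈-preimage⁻ (c i) T (choose-⊆ (preimage (c i) T) p (fits i∈ p∈) j∈)

    poor⇒β≤∣colours∣ : ∀ i → (∀ T → ∣ T ∣ ≤ a → ∣ preimage (c i) T ∣ < Δ) → β ≤ ∣ image (c i) ⊤ ∣
    poor⇒β≤∣colours∣ i poor with ∣ image (c i) ⊤ ∣ ≤? a + b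
    ... | no ∣image∣≰a+b = ≰⇒> ∣image∣≰a+b
    ... | yes ∣image∣≤a+b = ⊥-elim (<⇒≱ D+b*m<q (begin
      q            ≡⟨ ∣⊤∣≡n q ⟨
      ∣ ⊤ {q} ∣    ≤⟨ few-colours⇒∣X∣≤D+b*M (c i) a D m D<a*[1+m] b ⊤ ∣image∣≤a+b few-in-a-colours ⟩
      D + b * m    ∎))
      where
      open ≤-Reasoning
      few-in-a-colours : ∀ T → ∣ T ∣ ≤ a → ∣ ⊤ ∩ preimage (c i) T ∣ ≤ D
      few-in-a-colours T ∣T∣≤a =
        ≤-trans (∣p∩q∣≤∣q∣ ⊤ (preimage (c i) T)) (≤-pred (subst (∣ preimage (c i) T ∣ <_) Δ≡1+D (poor T ∣T∣≤a)))

    richSomewhere : Subset n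
    richSomewhere = ⋃ (List.map richClasses (subsetsOfSize k a))

    rich-or-many-colours : a ≤ k → ∀ i → i ∈ richSomewhere ⊎ β ≤ ∣ image (c i) ⊤ ∣
    rich-or-many-colours a≤k i with anySubset? (λ T → (∣ T ∣ ≤? a) ×-dec (Δ ≤? ∣ preimage (c i) T ∣))
    ... | no none = inj₂ (poor⇒β≤∣colours∣ i (λ T ∣T∣≤a → ≰⇒> (λ Δ≤ → none (T , ∣T∣≤a , Δ≤))))
    ... | yes (T , ∣T∣≤a , Δ≤) =
      let (T′ , T⊆T′ , _ , ∣T′∣≡a) = subset-between T ⊤ a (λ _ → ∈⊤) ∣T∣≤a (≤-trans a≤k (≤-reflexive (sym (∣⊤∣≡n k))))
      in inj₁ (∈-⋃⁺ _ (∈-map⁺ richClasses (subst (λ a → T′ ∈ₗ subsetsOfSize k a) ∣T′∣≡a (∈-subsetsOfSize T′)))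
                (∈-fromDec⁺ (λ i → Δ ≤? ∣ preimage (c i) T′ ∣)
                  (≤-trans Δ≤ (p⊆q⇒∣p∣≤∣q∣ (preimage-mono (c i) T⊆T′)))))

    module _ (c-valid : IsColouring n r q σ (suc a) β k c) where

      ∣richClasses∣<s : ∀ T → ∣ T ∣ ≤ a → ∣ richClasses T ∣ < length σ
      ∣richClasses∣<s T ∣T∣≤a = ≰⇒> λ s≤∣rich∣ →
        let (S , S⊆rich , ∣S∣≡s) = subset-of-size (richClasses T) (length σ) s≤∣rich∣
            (K , K-edge , colours⊆T) = edge-coloured-within T S ∣S∣≡s S⊆rich
        in 1+n≰n (begin
          suc a                ≤⟨ proj₁ (proj₂ c-valid K K-edge) ⟩
          numColours c K       ≤⟨ p⊆q⇒∣p∣≤∣q∣ colours⊆T ⟩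
          ∣ T ∣                ≤⟨ ∣T∣≤a ⟩
          a                    ∎)
        where open ≤-Reasoning

      ∣richSomewhere∣≤ : ∣ richSomewhere ∣ ≤ (k C a) * (length σ ∸ 1)
      ∣richSomewhere∣≤ = ≤-trans (∣⋃ps∣≤length*b (List.map richClasses (subsetsOfSize k a)) (length σ ∸ 1) bound)
        (≤-reflexive (cong (_* (length σ ∸ 1)) (trans (length-map richClasses (subsetsOfSize k a)) (length-subsetsOfSize k a))))
        where
        bound : ∀ {p} → p ∈ₗ List.map richClasses (subsetsOfSize k a) → ∣ p ∣ ≤ length σ ∸ 1
        bound p∈ with ∈-map⁻ richClasses p∈
        ... | (T , T∈ , refl) = ∸-monoˡ-≤ 1 (∣richClasses∣<s T (≤-reflexive (∈-subsetsOfSize⇒∣T∣≡a k a T∈)))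

      a≤k : ((β + 1) C a) * (length σ ∸ 1) + length σ ≤ n → a ≤ k
      a≤k n-large = ≮⇒≥ λ k<a → <⇒≱ (∣richClasses∣<s ⊤ (≤-trans (≤-reflexive (∣⊤∣≡n k)) (<⇒≤ k<a))) (begin
        length σ           ≤⟨ m≤n+m (length σ) _ ⟩
        _                  ≤⟨ n-large ⟩
        n                  ≡⟨ ∣⊤∣≡n n ⟨
        ∣ ⊤ {n} ∣          ≤⟨ p⊆q⇒∣p∣≤∣q∣ {p = ⊤} (λ _ → ∈-fromDec⁺ (λ i → Δ ≤? ∣ preimage (c i) ⊤ ∣) Δ≤∣preimage⊤∣) ⟩
        ∣ richClasses ⊤ ∣  ∎)
        where
        open ≤-Reasoning
        Δ≤∣preimage⊤∣ : ∀ {i} → Δ ≤ ∣ preimage (c i) ⊤ ∣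
        Δ≤∣preimage⊤∣ {i} = ≤-trans Δ≤q (≤-reflexive (sym (∣preimage⊤∣≡q (c i))))

      β≤k : a < length σ → ((β + 1) C a) * (length σ ∸ 1) + length σ ≤ n → β ≤ k
      β≤k a<s n-large = ≮⇒≥ λ k<β → <⇒≱ (begin-strict
          ((β + 1) C a) * (length σ ∸ 1)             <⟨ m<m+n _ (≤-trans (s≤s z≤n) a<s) ⟩
          ((β + 1) C a) * (length σ ∸ 1) + length σ  ≤⟨ n-large ⟩
          n                                          ∎) (begin
          n                                          ≡⟨ ∣⊤∣≡n n ⟨
          ∣ ⊤ {n} ∣                                  ≤⟨ p⊆q⇒∣p∣≤∣q∣ {p = ⊤} (all-rich k<β) ⟩
          ∣ richSomewhere ∣                          ≤⟨ ∣richSomewhere∣≤ ⟩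
          (k C a) * (length σ ∸ 1)                   ≤⟨ *-monoˡ-≤ (length σ ∸ 1) (C-monoˡ-≤ a (≤-trans (<⇒≤ k<β) (m≤m+n β 1))) ⟩
          ((β + 1) C a) * (length σ ∸ 1)             ∎)
        where
        open ≤-Reasoning
        all-rich : k < β → ⊤ ⊆ richSomewhere
        all-rich k<β {i} _ = Sum.[ (λ i∈ → i∈) , (λ β≤∣image∣ → ⊥-elim (<⇒≱ k<β (≤-trans β≤∣image∣ (∣p∣≤n (image (c i) ⊤))))) ]′
          (rich-or-many-colours (a≤k n-large) i)

      opaque
        opening-class : ∀ d δ → 1 ≤ δ → δ ≤ q → β ≤ ∣ image (c d) ⊤ ∣ → β < k → ∀ e′ → e′ ≢ d →
          ∃[ e ] ∃[ A ] e ≢ d × ∣ A ∣ ≡ δ × 1 ≤ ∣ image (c e) A ∣ × β < ∣ image (c e) A ∪ image (c d) ⊤ ∣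
        opening-class d δ 1≤δ δ≤q β≤∣I∣ β<k e′ e′≢d with any? (λ x → ¬? (x ∈? image (c d) ⊤))
        ... | yes (x , x∉I) =
          let (e , j , cej≡x) = proj₁ c-valid x
              (A , j∈A , _ , ∣A∣≡δ) = subset-between ⁅ j ⁆ ⊤ δ (λ _ → ∈⊤)
                                        (≤-trans (≤-reflexive (∣⁅x⁆∣≡1 j)) 1≤δ) (≤-trans δ≤q (≤-reflexive (sym (∣⊤∣≡n q))))
              x∈ : x ∈ image (c e) A
              x∈ = subst (_∈ image (c e) A) cej≡x (∈-image⁺ (c e) (j∈A (x∈⁅x⁆ j)))
          in e , A , (λ { refl → x∉I (subst (_∈ image (c d) ⊤) cej≡x (∈-image⁺ (c d) ∈⊤)) }) , ∣A∣≡δ ,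
             x∈p⇒1≤∣p∣ x∈ , (begin-strict
               β                                   <⟨ s≤s β≤∣I∣ ⟩
               suc ∣ image (c d) ⊤ ∣                ≡⟨ +-comm 1 _ ⟩
               ∣ image (c d) ⊤ ∣ + 1                ≡⟨ cong (∣ image (c d) ⊤ ∣ +_) (∣⁅x⁆∣≡1 x) ⟨
               ∣ image (c d) ⊤ ∣ + ∣ ⁅ x ⁆ ∣        ≡⟨ disjoint⇒∣p∪q∣≡∣p∣+∣q∣ (image (c d) ⊤) ⁅ x ⁆
                                                         (λ y∈I y∈⁅x⁆ → x∉I (subst (_∈ image (c d) ⊤) (x∈⁅y⁆⇒x≡y x y∈⁅x⁆) y∈I)) ⟨
               ∣ image (c d) ⊤ ∪ ⁅ x ⁆ ∣            ≤⟨ p⊆q⇒∣p∣≤∣q∣ (∪-⊆ (q⊆p∪q (image (c e) A) (image (c d) ⊤))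
                                                         (λ y∈⁅x⁆ → p⊆p∪q _ (subst (_∈ image (c e) A) (sym (x∈⁅y⁆⇒x≡y x y∈⁅x⁆)) x∈))) ⟩
               ∣ image (c e) A ∪ image (c d) ⊤ ∣    ∎)
          where open ≤-Reasoning
        ... | no none =
          let (j , j∈A) = 1≤∣p∣⇒nonempty (choose (⊤ {q}) δ) (subst (1 ≤_) (sym ∣A∣≡δ) 1≤δ)
          in e′ , choose (⊤ {q}) δ , e′≢d , ∣A∣≡δ , x∈p⇒1≤∣p∣ (∈-image⁺ (c e′) j∈A) , (begin-strict
               β                                          <⟨ β<k ⟩
               k                                          ≡⟨ ∣⊤∣≡n k ⟨
               ∣ ⊤ {k} ∣                                  ≤⟨ p⊆q⇒∣p∣≤∣q∣ {p = ⊤} all-in-I ⟩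
               ∣ image (c d) ⊤ ∣                          ≤⟨ ∣q∣≤∣p∪q∣ (image (c e′) (choose (⊤ {q}) δ)) (image (c d) ⊤) ⟩
               ∣ image (c e′) (choose (⊤ {q}) δ) ∪ image (c d) ⊤ ∣ ∎)
          where
          open ≤-Reasoning
          ∣A∣≡δ : ∣ choose (⊤ {q}) δ ∣ ≡ δ
          ∣A∣≡δ = ∣choose∣≡k (⊤ {q}) δ (≤-trans δ≤q (≤-reflexive (sym (∣⊤∣≡n q))))
          all-in-I : ⊤ ⊆ image (c d) ⊤
          all-in-I {x} _ with x ∈? image (c d) ⊤
          ... | yes x∈ = x∈
          ... | no x∉ = ⊥-elim (none (x , x∉))

      edge-through : ∀ {δ p σ₂} → σ ↭ δ ∷ p ∷ σ₂ → δ + β ≤ r → ∀ P → (∀ {i} → i ∈ P → β ≤ ∣ image (c i) ⊤ ∣) →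
        ∀ d e A-e S → e ≢ d → ∣ A-e ∣ ≡ δ → 1 ≤ ∣ image (c e) A-e ∣ → β < ∣ image (c e) A-e ∪ image (c d) ⊤ ∣ →
        S ⊆ P - d - e → ∣ S ∣ ≡ length σ₂ → ∃[ K ] IsEdge n r q σ K × β < numColours c K
      edge-through {δ} {p} {σ₂} σ↭ δ+β≤r P many d e A-e S e≢d ∣A-e∣≡δ 1≤∣U-e∣ β<∣U-e∪I∣ S⊆ ∣S∣≡∣σ₂∣ =
        assemble ps , K-edge , (begin-strict
          β                               <⟨ β<∣F∣ ⟩
          ∣ F ∣                           ≤⟨ p⊆q⇒∣p∣≤∣q∣ F⊆colours ⟩
          numColours c (assemble ps)      ∎)
        where
        open ≤-Reasoning
        ∈σ : ∀ {x} → x ∈ₗ δ ∷ p ∷ σ₂ → x ∈ₗ σ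
        ∈σ x∈ = ∈-resp-↭ (↭-sym σ↭) x∈
        I U-e U-f F : Subset k
        I = image (c d) ⊤
        U-e = image (c e) A-e
        ∈S⇒∈P-d-e : ∀ {i} → i ∈ₗ elements S → i ∈ P - d - e
        ∈S⇒∈P-d-e i∈ = S⊆ (∈-elements⁻ S i∈)
        collected : Collected c j₀ β (elements S) σ₂ U-e
        collected = collect c j₀ β (elements S) σ₂ (trans (length-elements S) ∣S∣≡∣σ₂∣)
          (λ i∈ → many (─⁻ˡ (─⁻ˡ (∈S⇒∈P-d-e i∈)))) (All.tabulate (λ x∈ → part≤q (∈σ (Any.there (Any.there x∈))))) U-e
        L = proj₁ collected
        U-f = U-e ∪ coloursOf c L
        closing = add-class (c d) j₀ U-f p (part≤q (∈σ (Any.there (Any.here refl))))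
        A-d = proj₁ closing
        F = U-f ∪ image (c d) A-d
        ps = (e , A-e) ∷ (d , A-d) ∷ L
        unique : Unique (classes ps)
        unique = subst (λ is → Unique (e ∷ d ∷ is)) (sym (proj₁ (proj₂ collected)))
          ((e≢d All.∷ All.tabulate (λ i∈ e≡i → ─⁻ʳ (∈S⇒∈P-d-e i∈) (subst (_∈ ⁅ e ⁆) e≡i (x∈⁅x⁆ e))))
           ∷ (All.tabulate (λ i∈ d≡i → ─⁻ʳ (─⁻ˡ (∈S⇒∈P-d-e i∈)) (subst (_∈ ⁅ d ⁆) d≡i (x∈⁅x⁆ d))) ∷ elements-unique S))
        sizes≡ : sizes ps ≡ δ ∷ p ∷ σ₂
        sizes≡ = cong₂ _∷_ ∣A-e∣≡δ (cong₂ _∷_ (proj₁ (proj₂ closing)) (proj₁ (proj₂ (proj₂ collected))))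
        K-edge : IsEdge n r q σ (assemble ps)
        K-edge = assemble-isEdge ps unique
          (All-map⁻ (subst (All (1 ≤_)) (sym sizes≡) (All.tabulate (λ x∈ → part-positive (∈σ x∈)))))
          (subst (_↭ σ) (sym sizes≡) (↭-sym σ↭)) sum-σ
        F⊆colours : F ⊆ coloursOn c (assemble ps)
        F⊆colours y∈ = coloursOf⊆coloursOn-assemble c ps unique
          (∪-⊆ (∪-⊆ (image⊆coloursOf c ps (Any.here refl))
                     (coloursOf-⊆ c L (λ i,A∈ → image⊆coloursOf c ps (Any.there (Any.there i,A∈)))))
               (image⊆coloursOf c ps (Any.there (Any.here refl))) y∈)
        β<∣F∣ : β < ∣ F ∣
        β<∣F∣ = colour-count-exceeds-β 1≤∣U-e∣ β<∣U-e∪I∣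
          (p⊆q⇒∣p∣≤∣q∣ (∪-⊆ (λ y∈ → p⊆p∪q I (p⊆p∪q (coloursOf c L) y∈)) (q⊆p∪q U-f I)))
          (part-positive (∈σ (Any.there (Any.here refl)))) δ+β≤r (trans (sym (sum-↭ σ↭)) sum-σ)
          (proj₂ (proj₂ (proj₂ collected))) (proj₂ (proj₂ closing))

      edge-with-many-colours : ∀ {δ} → δ ∈ₗ σ → δ + β ≤ r → β < k → (P : Subset n) →
        2 ≤ length σ → length σ ≤ ∣ P ∣ → (∀ {i} → i ∈ P → β ≤ ∣ image (c i) ⊤ ∣) →
        ∃[ K ] IsEdge n r q σ K × β < numColours c K
      edge-with-many-colours {δ} δ∈σ δ+β≤r β<k P 2≤s s≤∣P∣ many with split-out δ∈σ 2≤s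
      ... | (p , σ₂ , σ↭) =
        let (d , d∈P) = 1≤∣p∣⇒nonempty P (≤-trans (≤-trans (s≤s z≤n) 2≤s) s≤∣P∣)
            (e′ , e′∈P-d) = 1≤∣p∣⇒nonempty (P - d) (≤-pred (≤-trans 2≤s (≤-trans s≤∣P∣ (∣p∣≤1+∣p-x∣ P d))))
            (e , A-e , e≢d , ∣A-e∣≡δ , 1≤∣U-e∣ , β<∣U-e∪I∣) =
              opening-class d δ (part-positive δ∈σ) (part≤q δ∈σ) (many d∈P) β<k e′ (x∉⁅y⁆⇒x≢y (─⁻ʳ e′∈P-d))
            (S , S⊆ , ∣S∣≡∣σ₂∣) = subset-of-size (P - d - e) (length σ₂) (room d e)
        in edge-through σ↭ δ+β≤r P many d e A-e S e≢d ∣A-e∣≡δ 1≤∣U-e∣ β<∣U-e∪I∣ S⊆ ∣S∣≡∣σ₂∣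
        where
        room : ∀ d e → length σ₂ ≤ ∣ P - d - e ∣
        room d e = ≤-pred (≤-pred (begin
          suc (suc (length σ₂))   ≡⟨ ↭-length σ↭ ⟨
          length σ                ≤⟨ s≤∣P∣ ⟩
          ∣ P ∣                   ≤⟨ ∣p∣≤1+∣p-x∣ P d ⟩
          suc ∣ P - d ∣           ≤⟨ s≤s (∣p∣≤1+∣p-x∣ (P - d) e) ⟩
          suc (suc ∣ P - d - e ∣) ∎))
          where open ≤-Reasoning

      k≢β+1 : a < length σ → length σ ≤ β → ∀ {δ} → δ ∈ₗ σ → δ + β ≤ r →
        ((β + 1) C a) * (length σ ∸ 1) + length σ ≤ n → k ≢ β + 1
      k≢β+1 a<s s≤β δ∈σ δ+β≤r n-large k≡β+1 =
        let (K , K-edge , β<colours) = edge-with-many-colours δ∈σ δ+β≤r β<k poor 2≤s s≤∣poor∣ many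
        in <⇒≱ β<colours (proj₂ (proj₂ c-valid K K-edge))
        where
        open ≤-Reasoning
        poor : Subset n
        poor = ∁ richSomewhere
        β<k : β < k
        β<k = ≤-reflexive (trans (+-comm 1 β) (sym k≡β+1))
        2≤s : 2 ≤ length σ
        2≤s = ≤-trans (s≤s (>-nonZero⁻¹ a)) a<s
        s≤∣poor∣ : length σ ≤ ∣ poor ∣
        s≤∣poor∣ = begin
          length σ                                  ≡⟨ m+n∸m≡n X (length σ) ⟨
          X + length σ ∸ X                          ≤⟨ ∸-monoˡ-≤ X n-large ⟩
          n ∸ X                                     ≤⟨ ∸-monoʳ-≤ n (subst (λ k → ∣ richSomewhere ∣ ≤ (k C a) * (length σ ∸ 1))
                                                                           k≡β+1 ∣richSomewhere∣≤) ⟩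
          n ∸ ∣ richSomewhere ∣                     ≡⟨ ∣∁p∣≡n∸∣p∣ richSomewhere ⟨
          ∣ poor ∣                                  ∎
          where X = ((β + 1) C a) * (length σ ∸ 1)
        many : ∀ {i} → i ∈ poor → β ≤ ∣ image (c i) ⊤ ∣
        many {i} i∈ = Sum.[ (λ i∈rich → ⊥-elim (x∈∁p⇒x∉p i∈ i∈rich)) , (λ β≤∣image∣ → β≤∣image∣) ]′
          (rich-or-many-colours (a≤k n-large) i)

  no-colouring-below-β : ∀ {n r σ} → All (1 ≤_) σ → sum σ ≡ r → All (_≤ Δ) σ → a < length σ →
    ((β + 1) C a) * (length σ ∸ 1) + length σ ≤ n →
    ∀ k → k ≤ β ∸ 1 → ¬ HasColouring n r q σ (suc a) β k
  no-colouring-below-β σ-pos sum-σ σ≤Δ a<s n-large k k≤β∸1 (c , c-valid) =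
    1+n≰n (≤-trans (β≤k σ-pos sum-σ σ≤Δ c c-valid a<s n-large) k≤β∸1)

  no-colouring-with-β+1 : ∀ {n r σ δ} → All (1 ≤_) σ → sum σ ≡ r → All (_≤ Δ) σ → a < length σ →
    length σ ≤ β → δ ∈ₗ σ → δ + β ≤ r → ((β + 1) C a) * (length σ ∸ 1) + length σ ≤ n →
    ¬ HasColouring n r q σ (suc a) β (β + 1)
  no-colouring-with-β+1 σ-pos sum-σ σ≤Δ a<s s≤β δ∈σ δ+β≤r n-large (c , c-valid) =
    k≢β+1 σ-pos sum-σ σ≤Δ c c-valid a<s s≤β δ∈σ δ+β≤r n-large refl

β+1<n : ∀ {n s} a β → 1 ≤ a → a < s → s ≤ β → ((β + 1) C a) * (s ∸ 1) + s ≤ n → β + 1 < n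
β+1<n {n} {s} a β 1≤a a<s s≤β n-large = begin-strict
  β + 1                         ≤⟨ n≤nCk (β + 1) a 1≤a (≤-trans a<s (≤-trans s≤β (m≤m+n β 1))) ⟩
  (β + 1) C a                   ≤⟨ 1≤n⇒m≤n*m ((β + 1) C a) 1≤s∸1 ⟩
  (s ∸ 1) * ((β + 1) C a)       ≡⟨ *-comm (s ∸ 1) _ ⟩
  ((β + 1) C a) * (s ∸ 1)       <⟨ m<m+n _ (≤-trans 1≤a (<⇒≤ a<s)) ⟩
  ((β + 1) C a) * (s ∸ 1) + s   ≤⟨ n-large ⟩
  n                             ∎
  where
  open ≤-Reasoning
  1≤s∸1 : 1 ≤ s ∸ 1
  1≤s∸1 = ∸-monoˡ-≤ 1 (≤-trans (s≤s 1≤a) a<s)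

q-formula : ∀ a b Δ .{{_ : NonZero a}} → a < Δ →
  (suc a + b ∸ suc a + 1) * ((Δ ∸ 1) / a) + Δ ∸ 1 ≡ Constants.q a b Δ
q-formula a b Δ a<Δ = begin
  (suc a + b ∸ suc a + 1) * ((Δ ∸ 1) / a) + Δ ∸ 1     ≡⟨ +-∸-assoc _ (≤-trans (s≤s z≤n) a<Δ) ⟩
  (suc a + b ∸ suc a + 1) * ((Δ ∸ 1) / a) + (Δ ∸ 1)   ≡⟨ cong (λ x → (x + 1) * ((Δ ∸ 1) / a) + (Δ ∸ 1)) (m+n∸m≡n (suc a) b) ⟩
  (b + 1) * ((Δ ∸ 1) / a) + (Δ ∸ 1)                   ∎
  where open ≡-Reasoning

theorem5p1 : (r : ℕ) (σ : List ℕ) (Δ δ n q α β : ℕ) →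
    1 ≤ r → IsPartition σ r →
    Δ ∈ₗ σ → All (_≤ Δ) σ →
    δ ∈ₗ σ → All (δ ≤_) σ →
    1 ≤ n → 1 ≤ q →
    2 ≤ α → α ≤ Δ → δ + β ≤ r →
    α ≤ length σ → length σ ≤ β →
    q ≡ (β ∸ α + 1) * ⌊ Δ ∸ 1 / α ∸ 1 ⌋ + Δ ∸ 1 →
    ((β + 1) C (α ∸ 1)) * (length σ ∸ 1) + length σ ≤ n →
    (∀ k → k ≤ β ∸ 1 → ¬ HasColouring n r q σ α β k)
    × HasColouring n r q σ α β β
    × ¬ HasColouring n r q σ α β (β + 1)
    × (∀ k → ⌈ n ∸ (length σ ∸ 1 ∸ (α ∸ 1) * ⌊ length σ ∸ 1 / α ∸ 1 ⌋)
    / ⌊ length σ ∸ 1 / α ∸ 1 ⌋ ⌉ ≤ k → k ≤ n →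
    HasColouring n r q σ α β k)
    × SpectrumHasGap n r q σ α β
theorem5p1 r σ Δ δ n q .(suc (suc a′)) β _ (σ-pos , sum-σ) Δ∈σ σ≤Δ δ∈σ _ 1≤n 1≤q (s≤s (s≤s (z≤n {a′})))
  α≤Δ δ+β≤r α≤s s≤β q≡ n-large with m≤n⇒∃[o]m+o≡n (≤-trans α≤s s≤β)
... | (b , refl) rewrite trans q≡ (q-formula (suc a′) b Δ α≤Δ) =
  no-colouring-below-β a b Δ α≤Δ σ-pos sum-σ σ≤Δ α≤s n-large ,
  β-colouring a b Δ α≤Δ 1≤n Δ∈σ ,
  no-colouring-with-β+1 a b Δ α≤Δ σ-pos sum-σ σ≤Δ α≤s s≤β δ∈σ δ+β≤r n-large ,
  class-colouring a β 1≤q α≤s s≤β s≤n ,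
  (β , β + 1 , n , m<m+n β (s≤s z≤n) , β+1<n a β (s≤s z≤n) α≤s s≤β n-large ,
   β-colouring a b Δ α≤Δ 1≤n Δ∈σ ,
   no-colouring-with-β+1 a b Δ α≤Δ σ-pos sum-σ σ≤Δ α≤s s≤β δ∈σ δ+β≤r n-large ,
   n-colouring a β 1≤q α≤s s≤β s≤n)
  where
  a : ℕ
  a = suc a′
  s≤n : length σ ≤ n
  s≤n = ≤-trans (m≤n+m (length σ) _) n-large
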